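{- Let $p\geq 1$. The generating function of the distance cube polynomials of the Fibonacci $p$-cubes is $$\sum_{n\geq 0}D_{\Gamma_n^p}(x,q)t^n=\frac{1+(q+x)t+(q+x)t^2+\cdots+(q+x)t^p}{1-t-(q+x)t^{p+1}}.$$
   Context: For $p\geq 1$, a Fibonacci $p$-string of length $n$ is a binary string of length $n$ in which any two 1s are separated by at least $p$ 0s. The Fibonacci $p$-cube $\Gamma_n^p$ is the subgraph of the hypercube $Q_n$ (vertex set $\{0,1\}^n$, adjacency = differing in exactly one coordinate) induced by the Fibonacci $p$-strings of length $n$; $\Gamma_0^p=K_1$. Every induced subgraph $H$ of $Q_n$ isomorphic to $Q_k$ has a unique vertex of minimal Hamming weight, its bottom vertex. For a subgraph $G$ of $Q_n$ containing $0^n$, $c_{k,d}(G)$ is the number of induced subgraphs of $G$ isomorphic to $Q_k$ whose bottom vertex is at (Hamming) distance $d$ from $0^n$, and the distance cube polynomial is $D_G(x,q)=\sum_{k,d\geq0}c_{k,d}(G)x^kq^d$. The identity is of formal power series in $t$. -}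

module Defs where

open import Data.Bool using (Bool; true; false; _∧_; _∨_; not; if_then_else_)
open import Data.Nat using (ℕ; zero; suc; _+_; _∸_; _^_; _≡ᵇ_; _<ᵇ_; _⊔_; _⊓_)
open import Data.Integer as ℤ using (ℤ; +_)
open import Data.List using (List; []; _∷_; map; concatMap; length; filterᵇ; zip; _++_)
open import Data.Bool.ListAction using (all; any)
open import Data.Vec using (Vec; []; _∷_; lookup)
open import Data.Fin using (Fin; toℕ)
open import Data.Fin.Base using () renaming (zero to fz; suc to fs)
open import Data.Product using (_×_; _,_)

allVecs : (n : ℕ) → List (Vec Bool n)
allVecs zero    = [] ∷ []
allVecs (suc n) = concatMap (λ v → (false ∷ v) ∷ (true ∷ v) ∷ []) (allVecs n)

allFins : (n : ℕ) → List (Fin n)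
allFins zero    = []
allFins (suc n) = fz ∷ map fs (allFins n)

b2n : Bool → ℕ
b2n true  = 1
b2n false = 0

weight : ∀ {n} → Vec Bool n → ℕ
weight []       = 0
weight (b ∷ v)  = b2n b + weight v

xorB : Bool → Bool → Bool
xorB true  b = not b
xorB false b = b

hamming : ∀ {n} → Vec Bool n → Vec Bool n → ℕ
hamming []       []       = 0
hamming (a ∷ u)  (b ∷ v)  = b2n (xorB a b) + hamming u v

adjᵇ : ∀ {n} → Vec Bool n → Vec Bool n → Bool
adjᵇ u v = hamming u v ≡ᵇ 1

eqᵇ : ∀ {n} → Vec Bool n → Vec Bool n → Bool
eqᵇ u v = hamming u v ≡ᵇ 0

-- Fibonacci p-strings: any two 1s (positions i < j) are separated by
-- at least p 0s, i.e. j - i - 1 ≥ p.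

isFibᵇ : (p : ℕ) → ∀ {n} → Vec Bool n → Bool
isFibᵇ p {n} v =
  all (λ i → all (λ j →
         not ((toℕ i <ᵇ toℕ j) ∧ lookup v i ∧ lookup v j)
         ∨ (p <ᵇ (toℕ j ∸ toℕ i)))
       (allFins n))
      (allFins n)

fibVertices : (p n : ℕ) → List (Vec Bool n)
fibVertices p n = filterᵇ (isFibᵇ p) (allVecs n)

-- all sub-lists (= all subsets, when the list has no repetitions)
subsets : ∀ {A : Set} → List A → List (List A)
subsets []       = [] ∷ []
subsets (x ∷ xs) = let r = subsets xs in map (x ∷_) r ++ r

seqs : ∀ {A : Set} → ℕ → List A → List (List A)
seqs zero    S = [] ∷ []
seqs (suc m) S = concatMap (λ s → map (s ∷_) (seqs m S)) S

distinctᵇ : ∀ {n} → List (Vec Bool n) → Bool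
distinctᵇ []       = true
distinctᵇ (v ∷ vs) = all (λ w → not (eqᵇ v w)) vs ∧ distinctᵇ vs

-- An induced subgraph is determined by its vertex set S. The induced
-- subgraph Q_n[S] is isomorphic to Q_k iff there is a bijection
-- f : V(Q_k) → S with  a ~ b in Q_k  ⇔  f a ~ f b in Q_n.
-- f is encoded by its list of images of  allVecs k  (in order).

isCubeᵇ : ∀ {n} (k : ℕ) → List (Vec Bool n) → Bool
isCubeᵇ k S =
  (length S ≡ᵇ 2 ^ k) ∧
  any (λ imgs →
         distinctᵇ imgs ∧
         all (λ ab → all (λ cd →
               let (a , fa) = ab ; (b , fb) = cd in
               not (xorB (adjᵇ a b) (adjᵇ fa fb)))
             (zip (allVecs k) imgs))
           (zip (allVecs k) imgs))
      (seqs (2 ^ k) S)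

-- distance from 0^n of the bottom vertex (the unique vertex of
-- minimal Hamming weight) of a nonempty vertex set
minWeight : ∀ {n} → List (Vec Bool n) → ℕ
minWeight []       = 0
minWeight (v ∷ []) = weight v
minWeight (v ∷ vs@(_ ∷ _)) = weight v ⊓ minWeight vs

-- c_{k,d}(Γ_n^p): number of induced subgraphs of Γ_n^p isomorphic to Q_k
-- whose bottom vertex is at distance d from 0^n.
-- (Γ_n^p is an induced subgraph of Q_n, so its induced subgraphs are the
-- Q_n[S] with S ⊆ V(Γ_n^p).)
cFib : (p n k d : ℕ) → ℕ
cFib p n k d =
  length (filterᵇ (λ S → isCubeᵇ k S ∧ (minWeight S ≡ᵇ d))
                  (subsets (fibVertices p n)))

-- Polynomials in x, q with integer coefficients: Poly f means
-- Σ_{k,d} f k d x^k q^d (coefficient functions).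
-- Formal power series in t with coefficients in Z[x,q]: ℕ → Poly.

Poly : Set
Poly = ℕ → ℕ → ℤ

Series : Set
Series = ℕ → Poly

sumTo : ℕ → (ℕ → ℤ) → ℤ
sumTo zero    f = f 0
sumTo (suc n) f = sumTo n f ℤ.+ f (suc n)

_*ᴾ_ : Poly → Poly → Poly
(f *ᴾ g) k d = sumTo k (λ a → sumTo d (λ b → f a b ℤ.* g (k ∸ a) (d ∸ b)))

_*ˢ_ : Series → Series → Series
(F *ˢ G) n k d = sumTo n (λ i → (F i *ᴾ G (n ∸ i)) k d)

0ᴾ : Poly
0ᴾ _ _ = + 0

1ᴾ : Poly
1ᴾ zero zero = + 1
1ᴾ _    _    = + 0

q+xᴾ : Poly
q+xᴾ 1    0 = + 1
q+xᴾ 0    1 = + 1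
q+xᴾ _    _ = + 0

-_ᴾ : Poly → Poly
(-_ᴾ f) k d = ℤ.- f k d

Dfib : (p n : ℕ) → Poly
Dfib p n k d = + cFib p n k d

genFun : ℕ → Series
genFun p n = Dfib p n

-- numerator 1 + (q+x)t + (q+x)t^2 + ... + (q+x)t^p
numer : ℕ → Series
numer p zero    = 1ᴾ
numer p (suc m) = if m <ᵇ p then q+xᴾ else 0ᴾ

mono : ℕ → Poly → Series
mono m f n = if n ≡ᵇ m then f else 0ᴾ

_+ˢ_ : Series → Series → Series
(F +ˢ G) n k d = F n k d ℤ.+ G n k d

-ˢ_ : Series → Series
(-ˢ F) n k d = ℤ.- F n k d

denom : ℕ → Series
denom p = mono 0 1ᴾ +ˢ ((-ˢ mono 1 1ᴾ) +ˢ (-ˢ mono (suc p) q+xᴾ))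

{-# OPTIONS --safe #-}

-- Split the Fibonacci p-strings of length n + 1 by their first bit: those starting with 0 are
-- 0 Γ_n^p, those starting with 1 are 1u for the strings u of Γ_n^p that start with p zeros, and
-- the latter form a copy of Γ_{n-p}^p (for n < p the single string 0^n, a copy of Γ_0^p; so the
-- truncated n ∸ p is right).  An induced cube of Γ_{n+1}^p lies in the 0-layer, or in the
-- 1-layer (its bottom vertex one step further from 0^{n+1}), or meets both.  In the last case
-- the first coordinate is a direction of the cube along one edge, hence along all of them
-- (two edges at a vertex span a square), so the cube is an edge times a cube U of the
-- 1-layer together with the 0-copy of U: one dimension more, the same bottom weight.  Hence
-- D_{n+1} = D_n + (q + x) D_{n∸p} and D_0 = 1, and this recurrence says exactly that
-- (1 - t - (q + x) t^{p+1}) Σ D_n t^n is the numerator.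

module Submission where

open import Defs
open import Data.Bool using (Bool; true; false; _∧_; _∨_; not; if_then_else_; T; T?)
import Data.Bool.Properties as Bool
open import Data.Bool.Properties using (not-involutive; not-¬; T-∧)
open import Data.Bool.ListAction using (and; all; any)
open import Data.Empty using (⊥-elim)
open import Data.Fin using (Fin; toℕ; punchIn) renaming (zero to fz; suc to fs)
open import Data.Fin.Properties using () renaming (_≟_ to _≟ᶠ_)
import Data.Integer as ℤ
import Data.Integer.Properties as ℤ
open import Data.List using (List; []; _∷_; _++_; map; concatMap; length; zip; filterᵇ)
import Data.List.Properties as List
open import Data.List.Properties
  using (length-map; length-++; length-removeAt′; ∷-injective; map-∘; map-++; map-id; map-cong; ++-identityʳ;
         map-concatMap; concatMap-map; concatMap-++; concatMap-cong;
         filter-accept; filter-reject; filter-all; filter-none; filter-++)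
open import Data.List.Membership.Propositional using (_∈_; _─_; find; lose)
open import Data.List.Membership.Propositional.Properties
  using (∈-map⁺; ∈-map⁻; ∈-++⁺ˡ; ∈-++⁺ʳ; ∈-++⁻; ∈-concatMap⁺; ∈-concatMap⁻)
import Data.List.Membership.DecPropositional as DecMembership
open import Data.List.Relation.Binary.Permutation.Propositional as ↭ using (_↭_)
open import Data.List.Relation.Binary.Permutation.Propositional.Properties using (↭-length; ∈-resp-↭; shift; filter-↭)
open import Data.List.Relation.Binary.Subset.Propositional using (_⊆_)
open import Data.List.Relation.Unary.All as All using (All; []; _∷_)
open import Data.List.Relation.Unary.All.Properties using (all⁺; all⁻)
open import Data.List.Relation.Unary.Any as Any using (here; there; index)
open import Data.List.Relation.Unary.Any.Properties using (any⁺; any⁻)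
open import Data.List.Relation.Unary.Unique.Propositional using (Unique; []; _∷_)
import Data.List.Relation.Unary.Unique.Propositional.Properties as Unique
open import Data.Nat using (ℕ; zero; suc; _∸_; _^_; _≡ᵇ_; _<ᵇ_; _≤_; _<_; _≥_; z≤n; s≤s; _⊓_)
import Data.Nat.Properties as ℕ
open import Data.Product using (_×_; _,_; ∃-syntax; proj₁; proj₂)
open import Data.Sum using (_⊎_; inj₁; inj₂)
open import Data.Unit using (tt)
open import Data.Vec using (Vec; []; _∷_; head; tail; lookup; insertAt; removeAt)
open import Data.Vec.Properties using (≡-dec; insertAt-lookup; removeAt-insertAt; insertAt-removeAt)
open import Function using (_∘_; _⇔_; mk⇔; Equivalence)
open import Relation.Binary using (DecidableEquality)
open import Relation.Binary.PropositionalEquality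
open import Relation.Nullary using (¬_; Dec; yes; no; does)

module PowerSeries where
  open import Data.Integer using (ℤ; +_; -_; _+_; _*_)
  open import Data.Integer.Tactic.RingSolver using (solve-∀)
  open import Algebra.Properties.CommutativeSemigroup ℤ.+-commutativeSemigroup using (interchange)

  sumTo-cong : ∀ n {f g : ℕ → ℤ} → (∀ i → i ≤ n → f i ≡ g i) → sumTo n f ≡ sumTo n g
  sumTo-cong zero    f≡g = f≡g 0 z≤n
  sumTo-cong (suc n) f≡g =
    cong₂ _+_ (sumTo-cong n (λ i i≤n → f≡g i (ℕ.m≤n⇒m≤1+n i≤n))) (f≡g (suc n) ℕ.≤-refl)

  sumTo-zero : ∀ n {f : ℕ → ℤ} → (∀ i → i ≤ n → f i ≡ + 0) → sumTo n f ≡ + 0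
  sumTo-zero n f≡0 = trans (sumTo-cong n f≡0) (zeros n)
    where
    zeros : ∀ n → sumTo n (λ _ → + 0) ≡ + 0
    zeros zero    = refl
    zeros (suc n) = cong (_+ + 0) (zeros n)

  sumTo-single : ∀ n {f : ℕ → ℤ} i → i ≤ n → (∀ j → j ≤ n → j ≢ i → f j ≡ + 0) → sumTo n f ≡ f i
  sumTo-single zero    .0 z≤n _ = refl
  sumTo-single (suc n) {f} i i≤1+n f≡0 with i ℕ.≟ suc n
  ... | yes refl = trans (cong (_+ f (suc n)) (sumTo-zero n (λ j j≤n → f≡0 j (ℕ.m≤n⇒m≤1+n j≤n) (ℕ.<⇒≢ (s≤s j≤n)))))
                         (ℤ.+-identityˡ _)
  ... | no i≢1+n = trans (cong₂ _+_ (sumTo-single n i (ℕ.≤-pred (ℕ.≤∧≢⇒< i≤1+n i≢1+n))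
                                       (λ j j≤n → f≡0 j (ℕ.m≤n⇒m≤1+n j≤n)))
                                    (f≡0 (suc n) ℕ.≤-refl (i≢1+n ∘ sym)))
                         (ℤ.+-identityʳ _)

  sumTo-+ : ∀ n (f g : ℕ → ℤ) → sumTo n (λ i → f i + g i) ≡ sumTo n f + sumTo n g
  sumTo-+ zero    f g = refl
  sumTo-+ (suc n) f g = trans (cong (_+ (f (suc n) + g (suc n))) (sumTo-+ n f g))
                              (interchange (sumTo n f) (sumTo n g) (f (suc n)) (g (suc n)))

  sumTo-neg : ∀ n (f : ℕ → ℤ) → sumTo n (λ i → - f i) ≡ - sumTo n f
  sumTo-neg zero    f = refl
  sumTo-neg (suc n) f = trans (cong (_+ - f (suc n)) (sumTo-neg n f))
                              (sym (ℤ.neg-distrib-+ (sumTo n f) (f (suc n))))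

  x·_ : Poly → Poly
  (x· f) zero    d = + 0
  (x· f) (suc k) d = f k d

  q·_ : Poly → Poly
  (q· f) k zero    = + 0
  (q· f) k (suc d) = f k d

  x·-cong : ∀ {f g : Poly} → (∀ k d → f k d ≡ g k d) → ∀ k d → (x· f) k d ≡ (x· g) k d
  x·-cong f≡g zero    d = refl
  x·-cong f≡g (suc k) d = f≡g k d

  q·-cong : ∀ {f g : Poly} → (∀ k d → f k d ≡ g k d) → ∀ k d → (q· f) k d ≡ (q· g) k d
  q·-cong f≡g k zero    = refl
  q·-cong f≡g k (suc d) = f≡g k d

  q+xᴾ≡x·1ᴾ+q·1ᴾ : ∀ k d → q+xᴾ k d ≡ (x· 1ᴾ) k d + (q· 1ᴾ) k d
  q+xᴾ≡x·1ᴾ+q·1ᴾ zero          zero          = refl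
  q+xᴾ≡x·1ᴾ+q·1ᴾ zero          (suc zero)    = refl
  q+xᴾ≡x·1ᴾ+q·1ᴾ zero          (suc (suc d)) = refl
  q+xᴾ≡x·1ᴾ+q·1ᴾ (suc zero)    zero          = refl
  q+xᴾ≡x·1ᴾ+q·1ᴾ (suc zero)    (suc d)       = refl
  q+xᴾ≡x·1ᴾ+q·1ᴾ (suc (suc k)) zero          = refl
  q+xᴾ≡x·1ᴾ+q·1ᴾ (suc (suc k)) (suc d)       = refl

  *ᴾ-congʳ : ∀ f {g h : Poly} → (∀ a b → g a b ≡ h a b) → ∀ k d → (f *ᴾ g) k d ≡ (f *ᴾ h) k d
  *ᴾ-congʳ f g≡h k d = sumTo-cong k (λ a _ → sumTo-cong d (λ b _ → cong (f a b *_) (g≡h (k ∸ a) (d ∸ b))))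

  *ᴾ-distribˡ-+ : ∀ (f g h : Poly) k d → (f *ᴾ (λ a b → g a b + h a b)) k d ≡ (f *ᴾ g) k d + (f *ᴾ h) k d
  *ᴾ-distribˡ-+ f g h k d =
    trans (sumTo-cong k (λ a _ → trans (sumTo-cong d (λ b _ → ℤ.*-distribˡ-+ (f a b) _ _)) (sumTo-+ d _ _)))
          (sumTo-+ k _ _)

  *ᴾ-negʳ : ∀ (f g : Poly) k d → (f *ᴾ (λ a b → - g a b)) k d ≡ - (f *ᴾ g) k d
  *ᴾ-negʳ f g k d =
    trans (sumTo-cong k (λ a _ → trans (sumTo-cong d (λ b _ → sym (ℤ.neg-distribʳ-* (f a b) _))) (sumTo-neg d _)))
          (sumTo-neg k _)

  *ᴾ-zeroʳ : ∀ (f : Poly) k d → (f *ᴾ 0ᴾ) k d ≡ + 0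
  *ᴾ-zeroʳ f k d = sumTo-zero k (λ a _ → sumTo-zero d (λ b _ → ℤ.*-zeroʳ (f a b)))

  *ᴾ-identityʳ : ∀ (f : Poly) k d → (f *ᴾ 1ᴾ) k d ≡ f k d
  *ᴾ-identityʳ f k d = begin
    (f *ᴾ 1ᴾ) k d
      ≡⟨ sumTo-single k k ℕ.≤-refl (λ a a≤k a≢k →
           sumTo-zero d (λ b _ → off-originˡ a b (ℕ.m<n⇒0<n∸m (ℕ.≤∧≢⇒< a≤k a≢k)))) ⟩
    sumTo d (λ b → f k b * 1ᴾ (k ∸ k) (d ∸ b))
      ≡⟨ sumTo-single d d ℕ.≤-refl (λ b b≤d b≢d →
           off-originʳ b (ℕ.m<n⇒0<n∸m (ℕ.≤∧≢⇒< b≤d b≢d))) ⟩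
    f k d * 1ᴾ (k ∸ k) (d ∸ d)
      ≡⟨ cong₂ (λ i j → f k d * 1ᴾ i j) (ℕ.n∸n≡0 k) (ℕ.n∸n≡0 d) ⟩
    f k d * + 1
      ≡⟨ ℤ.*-identityʳ (f k d) ⟩
    f k d ∎
    where
    open ≡-Reasoning
    off-originˡ : ∀ a b → 0 < k ∸ a → f a b * 1ᴾ (k ∸ a) (d ∸ b) ≡ + 0
    off-originˡ a b 0<k∸a with k ∸ a | 0<k∸a
    ... | suc _ | _ = ℤ.*-zeroʳ (f a b)
    off-originʳ : ∀ b → 0 < d ∸ b → f k b * 1ᴾ (k ∸ k) (d ∸ b) ≡ + 0
    off-originʳ b 0<d∸b rewrite ℕ.n∸n≡0 k with d ∸ b | 0<d∸b
    ... | suc _ | _ = ℤ.*-zeroʳ (f k b)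

  *ᴾ-x· : ∀ (f g : Poly) k d → (f *ᴾ (x· g)) k d ≡ (x· (f *ᴾ g)) k d
  *ᴾ-x· f g zero    d = sumTo-zero d (λ b _ → ℤ.*-zeroʳ (f 0 b))
  *ᴾ-x· f g (suc k) d = begin
    sumTo k inner + sumTo d (λ b → f (suc k) b * (x· g) (suc k ∸ suc k) (d ∸ b))
      ≡⟨ cong₂ _+_ (sumTo-cong k (λ a a≤k → cong (λ i → sumTo d (λ b → f a b * (x· g) i (d ∸ b))) (ℕ.+-∸-assoc 1 a≤k)))
                   (sumTo-zero d (λ b _ → trans (cong (f (suc k) b *_) (x·-at-0 (ℕ.n∸n≡0 k) (d ∸ b))) (ℤ.*-zeroʳ (f (suc k) b)))) ⟩
    (f *ᴾ g) k d + + 0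
      ≡⟨ ℤ.+-identityʳ _ ⟩
    (f *ᴾ g) k d ∎
    where
    open ≡-Reasoning
    inner : ℕ → ℤ
    inner a = sumTo d (λ b → f a b * (x· g) (suc k ∸ a) (d ∸ b))
    x·-at-0 : ∀ {i} → i ≡ 0 → ∀ b → (x· g) i b ≡ + 0
    x·-at-0 refl b = refl

  *ᴾ-q· : ∀ (f g : Poly) k d → (f *ᴾ (q· g)) k d ≡ (q· (f *ᴾ g)) k d
  *ᴾ-q· f g k zero    = sumTo-zero k (λ a _ → ℤ.*-zeroʳ (f a 0))
  *ᴾ-q· f g k (suc d) = sumTo-cong k column
    where
    column : ∀ a → a ≤ k → sumTo (suc d) (λ b → f a b * (q· g) (k ∸ a) (suc d ∸ b))
                           ≡ sumTo d (λ b → f a b * g (k ∸ a) (d ∸ b))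
    column a _ = trans
      (cong₂ _+_ (sumTo-cong d (λ b b≤d → cong (λ j → f a b * (q· g) (k ∸ a) j) (ℕ.+-∸-assoc 1 b≤d)))
                 (trans (cong (λ j → f a (suc d) * (q· g) (k ∸ a) j) (ℕ.n∸n≡0 d)) (ℤ.*-zeroʳ (f a (suc d)))))
      (ℤ.+-identityʳ _)

  *ᴾ-q+xᴾ : ∀ (f : Poly) k d → (f *ᴾ q+xᴾ) k d ≡ (x· f) k d + (q· f) k d
  *ᴾ-q+xᴾ f k d = begin
    (f *ᴾ q+xᴾ) k d                             ≡⟨ *ᴾ-congʳ f q+xᴾ≡x·1ᴾ+q·1ᴾ k d ⟩
    (f *ᴾ (λ a b → (x· 1ᴾ) a b + (q· 1ᴾ) a b)) k d ≡⟨ *ᴾ-distribˡ-+ f (x· 1ᴾ) (q· 1ᴾ) k d ⟩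
    (f *ᴾ (x· 1ᴾ)) k d + (f *ᴾ (q· 1ᴾ)) k d     ≡⟨ cong₂ _+_ (*ᴾ-x· f 1ᴾ k d) (*ᴾ-q· f 1ᴾ k d) ⟩
    (x· (f *ᴾ 1ᴾ)) k d + (q· (f *ᴾ 1ᴾ)) k d     ≡⟨ cong₂ _+_ (x·-cong (*ᴾ-identityʳ f) k d) (q·-cong (*ᴾ-identityʳ f) k d) ⟩
    (x· f) k d + (q· f) k d                     ∎
    where open ≡-Reasoning

  mono-≢ : ∀ j m (g : Poly) → m ≢ j → mono j g m ≡ 0ᴾ
  mono-≢ j m g m≢j with m ≡ᵇ j in eq
  ... | true  = ⊥-elim (m≢j (ℕ.≡ᵇ⇒≡ m j (subst T (sym eq) tt)))
  ... | false = refl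

  mono-≡ : ∀ j (g : Poly) → mono j g j ≡ g
  mono-≡ j g with j ≡ᵇ j in eq
  ... | true  = refl
  ... | false = ⊥-elim (subst T eq (ℕ.≡⇒≡ᵇ j j refl))

  *ˢ-distribˡ-+ : ∀ (F G H : Series) n k d → (F *ˢ (G +ˢ H)) n k d ≡ (F *ˢ G) n k d + (F *ˢ H) n k d
  *ˢ-distribˡ-+ F G H n k d =
    trans (sumTo-cong n (λ i _ → *ᴾ-distribˡ-+ (F i) (G (n ∸ i)) (H (n ∸ i)) k d)) (sumTo-+ n _ _)

  *ˢ-negʳ : ∀ (F G : Series) n k d → (F *ˢ (-ˢ G)) n k d ≡ - (F *ˢ G) n k d
  *ˢ-negʳ F G n k d = trans (sumTo-cong n (λ i _ → *ᴾ-negʳ (F i) (G (n ∸ i)) k d)) (sumTo-neg n _)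

  *ˢ-mono-≤ : ∀ (F : Series) j g {n} → j ≤ n → ∀ k d → (F *ˢ mono j g) n k d ≡ (F (n ∸ j) *ᴾ g) k d
  *ˢ-mono-≤ F j g {n} j≤n k d =
    trans (sumTo-single n (n ∸ j) (ℕ.m∸n≤m n j) off-diagonal)
          (cong (λ h → (F (n ∸ j) *ᴾ h) k d) (trans (cong (mono j g) (ℕ.m∸[m∸n]≡n j≤n)) (mono-≡ j g)))
    where
    off-diagonal : ∀ i → i ≤ n → i ≢ n ∸ j → (F i *ᴾ mono j g (n ∸ i)) k d ≡ + 0
    off-diagonal i i≤n i≢n∸j =
      trans (cong (λ h → (F i *ᴾ h) k d)
                  (mono-≢ j (n ∸ i) g (λ n∸i≡j → i≢n∸j (trans (sym (ℕ.m∸[m∸n]≡n i≤n)) (cong (n ∸_) n∸i≡j)))))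
            (*ᴾ-zeroʳ (F i) k d)

  *ˢ-mono-> : ∀ (F : Series) j g {n} → n < j → ∀ k d → (F *ˢ mono j g) n k d ≡ + 0
  *ˢ-mono-> F j g {n} n<j k d = sumTo-zero n (λ i _ →
    trans (cong (λ h → (F i *ᴾ h) k d) (mono-≢ j (n ∸ i) g (ℕ.<⇒≢ (ℕ.≤-<-trans (ℕ.m∸n≤m n i) n<j))))
          (*ᴾ-zeroʳ (F i) k d))

  *ˢ-denom : ∀ p (F : Series) n k d →
    (F *ˢ denom p) n k d ≡
    (F *ˢ mono 0 1ᴾ) n k d + (- (F *ˢ mono 1 1ᴾ) n k d + - (F *ˢ mono (suc p) q+xᴾ) n k d)
  *ˢ-denom p F n k d =
    trans (*ˢ-distribˡ-+ F (mono 0 1ᴾ) ((-ˢ mono 1 1ᴾ) +ˢ (-ˢ mono (suc p) q+xᴾ)) n k d)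
          (cong (λ z → (F *ˢ mono 0 1ᴾ) n k d + z)
                (trans (*ˢ-distribˡ-+ F (-ˢ mono 1 1ᴾ) (-ˢ mono (suc p) q+xᴾ) n k d)
                       (cong₂ _+_ (*ˢ-negʳ F (mono 1 1ᴾ) n k d) (*ˢ-negʳ F (mono (suc p) q+xᴾ) n k d))))

  *ᴾ-q+xᴾ-of-1ᴾ : ∀ (f : Poly) → (∀ k d → f k d ≡ 1ᴾ k d) → ∀ k d → (f *ᴾ q+xᴾ) k d ≡ q+xᴾ k d
  *ᴾ-q+xᴾ-of-1ᴾ f f≡1ᴾ k d =
    trans (*ᴾ-q+xᴾ f k d)
          (trans (cong₂ _+_ (x·-cong f≡1ᴾ k d) (q·-cong f≡1ᴾ k d)) (sym (q+xᴾ≡x·1ᴾ+q·1ᴾ k d)))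

  recurrence⇒*ˢdenom≡numer :
    ∀ p (F : Series) →
    (∀ k d → F 0 k d ≡ 1ᴾ k d) →
    (∀ m k d → F (suc m) k d ≡ F m k d + (F (m ∸ p) *ᴾ q+xᴾ) k d) →
    ∀ n k d → (F *ˢ denom p) n k d ≡ numer p n k d
  recurrence⇒*ˢdenom≡numer p F F₀ F-suc zero k d = begin
    (F *ˢ denom p) 0 k d
      ≡⟨ *ˢ-denom p F 0 k d ⟩
    (F *ˢ mono 0 1ᴾ) 0 k d + (- (F *ˢ mono 1 1ᴾ) 0 k d + - (F *ˢ mono (suc p) q+xᴾ) 0 k d)
      ≡⟨ cong₂ (λ a b → a + (- b + - (F *ˢ mono (suc p) q+xᴾ) 0 k d))
               (*ˢ-mono-≤ F 0 1ᴾ z≤n k d) (*ˢ-mono-> F 1 1ᴾ (s≤s z≤n) k d) ⟩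
    (F 0 *ᴾ 1ᴾ) k d + (+ 0 + - (F *ˢ mono (suc p) q+xᴾ) 0 k d)
      ≡⟨ cong₂ (λ a c → a + (+ 0 + - c)) (*ᴾ-identityʳ (F 0) k d) (*ˢ-mono-> F (suc p) q+xᴾ (s≤s z≤n) k d) ⟩
    F 0 k d + + 0
      ≡⟨ trans (ℤ.+-identityʳ _) (F₀ k d) ⟩
    1ᴾ k d ∎
    where open ≡-Reasoning
  recurrence⇒*ˢdenom≡numer p F F₀ F-suc (suc m) k d
    rewrite *ˢ-denom p F (suc m) k d
          | *ˢ-mono-≤ F 0 1ᴾ (z≤n {suc m}) k d | *ᴾ-identityʳ (F (suc m)) k d | F-suc m k d
          | *ˢ-mono-≤ F 1 1ᴾ (s≤s (z≤n {m})) k d | *ᴾ-identityʳ (F m) k d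
          with m <ᵇ p in m<ᵇp
  ... | true  = begin
    F m k d + (F (m ∸ p) *ᴾ q+xᴾ) k d + (- F m k d + - (F *ˢ mono (suc p) q+xᴾ) (suc m) k d)
      ≡⟨ cong₂ (λ a c → F m k d + a + (- F m k d + - c))
               (trans (cong (λ i → (F i *ᴾ q+xᴾ) k d) (ℕ.m≤n⇒m∸n≡0 (ℕ.<⇒≤ m<p))) (*ᴾ-q+xᴾ-of-1ᴾ (F 0) F₀ k d))
               (*ˢ-mono-> F (suc p) q+xᴾ (s≤s m<p) k d) ⟩
    F m k d + q+xᴾ k d + (- F m k d + - + 0)
      ≡⟨ cancel (F m k d) (q+xᴾ k d) ⟩
    q+xᴾ k d ∎
    where
    open ≡-Reasoning
    m<p : m < p
    m<p = ℕ.<ᵇ⇒< m p (subst T (sym m<ᵇp) tt)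
    cancel : ∀ a c → a + c + (- a + - + 0) ≡ c
    cancel = solve-∀
  ... | false = begin
    F m k d + (F (m ∸ p) *ᴾ q+xᴾ) k d + (- F m k d + - (F *ˢ mono (suc p) q+xᴾ) (suc m) k d)
      ≡⟨ cong (λ c → F m k d + (F (m ∸ p) *ᴾ q+xᴾ) k d + (- F m k d + - c))
              (*ˢ-mono-≤ F (suc p) q+xᴾ (s≤s p≤m) k d) ⟩
    F m k d + (F (m ∸ p) *ᴾ q+xᴾ) k d + (- F m k d + - (F (m ∸ p) *ᴾ q+xᴾ) k d)
      ≡⟨ cancel (F m k d) ((F (m ∸ p) *ᴾ q+xᴾ) k d) ⟩
    + 0 ∎
    where
    open ≡-Reasoning
    p≤m : p ≤ m
    p≤m = ℕ.≮⇒≥ (λ m<p → subst T m<ᵇp (ℕ.<⇒<ᵇ m<p))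
    cancel : ∀ a c → a + c + (- a + - c) ≡ + 0
    cancel = solve-∀

open PowerSeries

open import Data.Nat using (_+_; _*_)
open import Algebra.Properties.CommutativeSemigroup ℕ.+-commutativeSemigroup using () renaming (interchange to +-interchange)

-- The hypercube

flipAt : ∀ {n} → Fin n → Vec Bool n → Vec Bool n
flipAt fz     (b ∷ v) = not b ∷ v
flipAt (fs i) (b ∷ v) = b ∷ flipAt i v

flipAt-involutive : ∀ {n} (i : Fin n) v → flipAt i (flipAt i v) ≡ v
flipAt-involutive fz     (b ∷ v) = cong (_∷ v) (not-involutive b)
flipAt-involutive (fs i) (b ∷ v) = cong (b ∷_) (flipAt-involutive i v)

flipAt-comm : ∀ {n} (i j : Fin n) v → flipAt i (flipAt j v) ≡ flipAt j (flipAt i v)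
flipAt-comm fz     fz     v       = refl
flipAt-comm fz     (fs j) (b ∷ v) = refl
flipAt-comm (fs i) fz     (b ∷ v) = refl
flipAt-comm (fs i) (fs j) (b ∷ v) = cong (b ∷_) (flipAt-comm i j v)

flipAt-injectiveˡ : ∀ {n} (i j : Fin n) v → flipAt i v ≡ flipAt j v → i ≡ j
flipAt-injectiveˡ fz     fz     v       eq = refl
flipAt-injectiveˡ fz     (fs j) (b ∷ v) eq = ⊥-elim (not-¬ refl (sym (cong head eq)))
flipAt-injectiveˡ (fs i) fz     (b ∷ v) eq = ⊥-elim (not-¬ refl (cong head eq))
flipAt-injectiveˡ (fs i) (fs j) (b ∷ v) eq = cong fs (flipAt-injectiveˡ i j v (cong tail eq))

lookup-flipAt : ∀ {n} (i : Fin n) v → lookup (flipAt i v) i ≡ not (lookup v i)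
lookup-flipAt fz     (b ∷ v) = refl
lookup-flipAt (fs i) (b ∷ v) = lookup-flipAt i v

lookup-flipAt-≢ : ∀ {n} (i j : Fin n) v → i ≢ j → lookup (flipAt i v) j ≡ lookup v j
lookup-flipAt-≢ fz     fz     v       i≢j = ⊥-elim (i≢j refl)
lookup-flipAt-≢ fz     (fs j) (b ∷ v) i≢j = refl
lookup-flipAt-≢ (fs i) fz     (b ∷ v) i≢j = refl
lookup-flipAt-≢ (fs i) (fs j) (b ∷ v) i≢j = lookup-flipAt-≢ i j v (i≢j ∘ cong fs)

hamming-refl : ∀ {n} (v : Vec Bool n) → hamming v v ≡ 0
hamming-refl []          = refl
hamming-refl (true ∷ v)  = hamming-refl v
hamming-refl (false ∷ v) = hamming-refl v

hamming≡0⇒≡ : ∀ {n} (u v : Vec Bool n) → hamming u v ≡ 0 → u ≡ v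
hamming≡0⇒≡ []          []          eq = refl
hamming≡0⇒≡ (true ∷ u)  (true ∷ v)  eq = cong (true ∷_) (hamming≡0⇒≡ u v eq)
hamming≡0⇒≡ (false ∷ u) (false ∷ v) eq = cong (false ∷_) (hamming≡0⇒≡ u v eq)

hamming≡1⇒flipAt : ∀ {n} (u v : Vec Bool n) → hamming u v ≡ 1 → ∃[ r ] v ≡ flipAt r u
hamming≡1⇒flipAt []          []          ()
hamming≡1⇒flipAt (true ∷ u)  (true ∷ v)  eq = let r , v≡ = hamming≡1⇒flipAt u v eq in fs r , cong (true ∷_) v≡
hamming≡1⇒flipAt (false ∷ u) (false ∷ v) eq = let r , v≡ = hamming≡1⇒flipAt u v eq in fs r , cong (false ∷_) v≡
hamming≡1⇒flipAt (true ∷ u)  (false ∷ v) eq = fz , cong (false ∷_) (sym (hamming≡0⇒≡ u v (ℕ.suc-injective eq)))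
hamming≡1⇒flipAt (false ∷ u) (true ∷ v)  eq = fz , cong (true ∷_) (sym (hamming≡0⇒≡ u v (ℕ.suc-injective eq)))

hamming-flipAt : ∀ {n} (r : Fin n) u → hamming u (flipAt r u) ≡ 1
hamming-flipAt fz     (true ∷ u)  = cong suc (hamming-refl u)
hamming-flipAt fz     (false ∷ u) = cong suc (hamming-refl u)
hamming-flipAt (fs r) (true ∷ u)  = hamming-flipAt r u
hamming-flipAt (fs r) (false ∷ u) = hamming-flipAt r u

Adjacent : ∀ {n} → Vec Bool n → Vec Bool n → Set
Adjacent u v = ∃[ r ] v ≡ flipAt r u

adjᵇ⇒Adjacent : ∀ {n} (u v : Vec Bool n) → T (adjᵇ u v) → Adjacent u v
adjᵇ⇒Adjacent u v adj = hamming≡1⇒flipAt u v (ℕ.≡ᵇ⇒≡ (hamming u v) 1 adj)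

adjᵇ-flipAt : ∀ {n} (r : Fin n) u → T (adjᵇ u (flipAt r u))
adjᵇ-flipAt r u = ℕ.≡⇒≡ᵇ _ 1 (hamming-flipAt r u)

eqᵇ⇒≡ : ∀ {n} (u v : Vec Bool n) → T (eqᵇ u v) → u ≡ v
eqᵇ⇒≡ u v eq = hamming≡0⇒≡ u v (ℕ.≡ᵇ⇒≡ (hamming u v) 0 eq)

eqᵇ-refl : ∀ {n} (u : Vec Bool n) → T (eqᵇ u u)
eqᵇ-refl u = ℕ.≡⇒≡ᵇ _ 0 (hamming-refl u)

common-neighbour : ∀ {n} (s t : Fin n) (x y : Vec Bool n) → s ≢ t →
                   Adjacent (flipAt s x) y → Adjacent (flipAt t x) y → y ≢ x →
                   y ≡ flipAt s (flipAt t x)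
common-neighbour s t x y s≢t (r , y≡r) (r′ , y≡r′) y≢x with r ≟ᶠ s
... | yes refl = ⊥-elim (y≢x (trans y≡r (flipAt-involutive r x)))
... | no r≢s = trans y≡r (trans (cong (λ i → flipAt i (flipAt s x)) r≡t) (flipAt-comm t s x))
  where
  same : flipAt r (flipAt s x) ≡ flipAt r′ (flipAt t x)
  same = trans (sym y≡r) y≡r′
  r′≡s : r′ ≡ s
  r′≡s with r′ ≟ᶠ s
  ... | yes r′≡s = r′≡s
  ... | no r′≢s = ⊥-elim (not-¬ refl (begin
    lookup x s                             ≡⟨ lookup-flipAt-≢ t s x (s≢t ∘ sym) ⟨
    lookup (flipAt t x) s                  ≡⟨ lookup-flipAt-≢ r′ s _ r′≢s ⟨
    lookup (flipAt r′ (flipAt t x)) s      ≡⟨ cong (λ w → lookup w s) same ⟨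
    lookup (flipAt r (flipAt s x)) s       ≡⟨ lookup-flipAt-≢ r s _ r≢s ⟩
    lookup (flipAt s x) s                  ≡⟨ lookup-flipAt s x ⟩
    not (lookup x s)                       ∎))
    where open ≡-Reasoning
  r≡t : r ≡ t
  r≡t = flipAt-injectiveˡ r t _
          (trans same (trans (cong (λ i → flipAt i (flipAt t x)) r′≡s) (flipAt-comm s t x)))

-- Finite enumerations

module _ {A : Set} where

  ∈-─ : ∀ {x z : A} {ys} (x∈ys : x ∈ ys) → z ∈ ys → z ≢ x → z ∈ ys ─ x∈ys
  ∈-─ (here refl)  (here refl)  z≢x = ⊥-elim (z≢x refl)
  ∈-─ (here _)     (there z∈ys) _   = z∈ys
  ∈-─ (there _)    (here refl)  _   = here refl
  ∈-─ (there x∈ys) (there z∈ys) z≢x = there (∈-─ x∈ys z∈ys z≢x)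

  Unique⇒length-≤ : ∀ {xs ys : List A} → Unique xs → xs ⊆ ys → length xs ≤ length ys
  Unique⇒length-≤ []                       _     = z≤n
  Unique⇒length-≤ {x ∷ xs} {ys} (x∉xs ∷ u) xs⊆ys =
    subst (suc (length xs) ≤_) (sym (length-removeAt′ ys (index x∈ys)))
          (s≤s (Unique⇒length-≤ u (λ z∈xs → ∈-─ x∈ys (xs⊆ys (there z∈xs)) (All.lookup x∉xs z∈xs ∘ sym))))
    where
    x∈ys : x ∈ ys
    x∈ys = xs⊆ys (here refl)

  module _ (_≟_ : DecidableEquality A) where
    open DecMembership _≟_ using (_∈?_)

    Unique-⊆-length⇒⊇ : ∀ {xs ys : List A} → Unique xs → xs ⊆ ys → length ys ≤ length xs → ys ⊆ xs
    Unique-⊆-length⇒⊇ {xs} {ys} u xs⊆ys ys≤xs {s} s∈ys with s ∈? xs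
    ... | yes s∈xs = s∈xs
    ... | no  s∉xs = ⊥-elim (ℕ.<-irrefl refl (ℕ.≤-trans xs<ys ys≤xs))
      where
      xs<ys : length xs < length ys
      xs<ys = subst (length xs <_) (sym (length-removeAt′ ys (index s∈ys)))
                (s≤s (Unique⇒length-≤ u (λ {x} x∈xs → ∈-─ s∈ys (xs⊆ys x∈xs) (λ { refl → s∉xs x∈xs }))))

bothPrefixes : ∀ {n} → Vec Bool n → List (Vec Bool (suc n))
bothPrefixes v = (false ∷ v) ∷ (true ∷ v) ∷ []

∈-allVecs : ∀ {n} (v : Vec Bool n) → v ∈ allVecs n
∈-allVecs []      = here refl
∈-allVecs (b ∷ v) = ∈-concatMap⁺ bothPrefixes (Any.map (λ { refl → prefix b }) (∈-allVecs v))
  where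
  prefix : ∀ b → (b ∷ v) ∈ bothPrefixes v
  prefix false = here refl
  prefix true  = there (here refl)

∈-bothPrefixes⁻ : ∀ {n} {b} {w : Vec Bool n} L → (b ∷ w) ∈ concatMap bothPrefixes L → w ∈ L
∈-bothPrefixes⁻ L b∷w∈ = Any.map tail-≡ (∈-concatMap⁻ bothPrefixes {xs = L} b∷w∈)
  where
  tail-≡ : ∀ {b w v} → (b ∷ w) ∈ bothPrefixes v → w ≡ v
  tail-≡ (here refl)         = refl
  tail-≡ (there (here refl)) = refl

allVecs-unique : ∀ n → Unique (allVecs n)
allVecs-unique zero    = [] ∷ []
allVecs-unique (suc n) = prefixes-unique (allVecs n) (allVecs-unique n)
  where
  fresh : ∀ {b} {v : Vec Bool n} L → All (v ≢_) L → All (b ∷ v ≢_) (concatMap bothPrefixes L)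
  fresh L v∉L = All.tabulate (λ { w∈ refl → All.lookup v∉L (∈-bothPrefixes⁻ L w∈) refl })
  prefixes-unique : (L : List (Vec Bool n)) → Unique L → Unique (concatMap bothPrefixes L)
  prefixes-unique []      []          = []
  prefixes-unique (v ∷ L) (v∉L ∷ uL) =
    ((λ ()) ∷ fresh L v∉L) ∷ fresh L v∉L ∷ prefixes-unique L uL

length-allVecs : ∀ n → length (allVecs n) ≡ 2 ^ n
length-allVecs zero    = refl
length-allVecs (suc n) = trans (doubles (allVecs n)) (cong (2 *_) (length-allVecs n))
  where
  doubles : ∀ L → length (concatMap bothPrefixes L) ≡ 2 * length L
  doubles []      = refl
  doubles (v ∷ L) = trans (cong (2 +_) (doubles L)) (sym (ℕ.*-distribˡ-+ 2 1 (length L)))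

module _ {A : Set} where

  seqs⁻ : ∀ m (S : List A) {ys} → ys ∈ seqs m S → length ys ≡ m × All (_∈ S) ys
  seqs⁻ zero    S (here refl) = refl , []
  seqs⁻ (suc m) S ys∈ with s , s∈S , ys∈′ ← find (∈-concatMap⁻ (λ s → map (s ∷_) (seqs m S)) {xs = S} ys∈)
                      with zs , zs∈ , refl ← ∈-map⁻ (s ∷_) ys∈′
    = let len , zs⊆S = seqs⁻ m S zs∈ in cong suc len , s∈S ∷ zs⊆S

  seqs⁺ : ∀ m (S : List A) {ys} → length ys ≡ m → All (_∈ S) ys → ys ∈ seqs m S
  seqs⁺ zero    S {[]}     refl []           = here refl
  seqs⁺ (suc m) S {y ∷ ys} len  (y∈S ∷ ys⊆S) =
    ∈-concatMap⁺ (λ s → map (s ∷_) (seqs m S))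
                 (lose y∈S (∈-map⁺ (y ∷_) (seqs⁺ m S (ℕ.suc-injective len) ys⊆S)))

module _ {A B : Set} where

  zip-total : ∀ (xs : List A) (ys : List B) {x} → length xs ≡ length ys → x ∈ xs → ∃[ y ] (x , y) ∈ zip xs ys
  zip-total (_ ∷ xs) (y ∷ ys) _   (here refl) = y , here refl
  zip-total (_ ∷ xs) (_ ∷ ys) len (there x∈) = let y , xy∈ = zip-total xs ys (ℕ.suc-injective len) x∈ in y , there xy∈

  ∈-zip⁻ʳ : ∀ (xs : List A) (ys : List B) {x y} → (x , y) ∈ zip xs ys → y ∈ ys
  ∈-zip⁻ʳ (_ ∷ xs) (_ ∷ ys) (here refl) = here refl
  ∈-zip⁻ʳ (_ ∷ xs) (_ ∷ ys) (there xy∈) = there (∈-zip⁻ʳ xs ys xy∈)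

  zip-injective : ∀ (xs : List A) (ys : List B) {a b y} → Unique ys →
                  (a , y) ∈ zip xs ys → (b , y) ∈ zip xs ys → a ≡ b
  zip-injective (_ ∷ xs) (_ ∷ ys) _          (here refl) (here refl) = refl
  zip-injective (_ ∷ xs) (_ ∷ ys) (y∉ ∷ _)   (here refl) (there by∈) = ⊥-elim (All.lookup y∉ (∈-zip⁻ʳ xs ys by∈) refl)
  zip-injective (_ ∷ xs) (_ ∷ ys) (y∉ ∷ _)   (there ay∈) (here refl) = ⊥-elim (All.lookup y∉ (∈-zip⁻ʳ xs ys ay∈) refl)
  zip-injective (_ ∷ xs) (_ ∷ ys) (_ ∷ u)    (there ay∈) (there by∈) = zip-injective xs ys u ay∈ by∈

  zip-map : ∀ (f : A → B) xs → zip xs (map f xs) ≡ map (λ x → x , f x) xs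
  zip-map f []       = refl
  zip-map f (x ∷ xs) = cong ((x , f x) ∷_) (zip-map f xs)

T-ext : ∀ {a b} → (T a → T b) → (T b → T a) → a ≡ b
T-ext {true}  {true}  _ _ = refl
T-ext {false} {false} _ _ = refl
T-ext {true}  {false} f _ = ⊥-elim (f tt)
T-ext {false} {true}  _ g = ⊥-elim (g tt)

T-not-eqᵇ⇔≢ : ∀ {n} (u v : Vec Bool n) → T (not (eqᵇ u v)) ⇔ u ≢ v
T-not-eqᵇ⇔≢ u v with eqᵇ u v in e
... | true  = mk⇔ (λ ()) (λ u≢v → u≢v (eqᵇ⇒≡ u v (subst T (sym e) tt)))
... | false = mk⇔ (λ { _ refl → subst T e (eqᵇ-refl u) }) _

distinctᵇ⇒Unique : ∀ {n} (vs : List (Vec Bool n)) → T (distinctᵇ vs) → Unique vs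
distinctᵇ⇒Unique []       _ = []
distinctᵇ⇒Unique (v ∷ vs) t =
  let fresh , rest = Equivalence.to T-∧ t
  in All.map (λ {w} → Equivalence.to (T-not-eqᵇ⇔≢ v w)) (all⁺ _ vs fresh) ∷ distinctᵇ⇒Unique vs rest

Unique⇒distinctᵇ : ∀ {n} (vs : List (Vec Bool n)) → Unique vs → T (distinctᵇ vs)
Unique⇒distinctᵇ []       []          = tt
Unique⇒distinctᵇ (v ∷ vs) (v∉vs ∷ u) =
  Equivalence.from T-∧ (all⁻ _ (All.map (λ {w} → Equivalence.from (T-not-eqᵇ⇔≢ v w)) v∉vs) , Unique⇒distinctᵇ vs u)

-- Induced cubes as embeddings of Q_k

T-not-xorB⇔≡ : ∀ a b → T (not (xorB a b)) ⇔ a ≡ b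
T-not-xorB⇔≡ true  true  = mk⇔ (λ _ → refl) _
T-not-xorB⇔≡ false false = mk⇔ (λ _ → refl) _
T-not-xorB⇔≡ true  false = mk⇔ (λ ()) (λ ())
T-not-xorB⇔≡ false true  = mk⇔ (λ ()) (λ ())

record CubeEmbedding (k : ℕ) {n} (S : List (Vec Bool n)) : Set where
  field
    embed         : Vec Bool k → Vec Bool n
    injective     : ∀ {a b} → embed a ≡ embed b → a ≡ b
    preserves-adj : ∀ a b → adjᵇ a b ≡ adjᵇ (embed a) (embed b)
    embed-∈       : ∀ a → embed a ∈ S

  images : List (Vec Bool n)
  images = map embed (allVecs k)

  images-unique : Unique images
  images-unique = Unique.map⁺ injective (allVecs-unique k)

  images⊆S : images ⊆ S
  images⊆S y∈ = let a , _ , y≡ = ∈-map⁻ embed y∈ in subst (_∈ S) (sym y≡) (embed-∈ a)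

  length-images : length images ≡ 2 ^ k
  length-images = trans (length-map embed (allVecs k)) (length-allVecs k)

compatibleᵇ : ∀ {k n} → Vec Bool k × Vec Bool n → Vec Bool k × Vec Bool n → Bool
compatibleᵇ ab cd = not (xorB (adjᵇ (proj₁ ab) (proj₁ cd)) (adjᵇ (proj₂ ab) (proj₂ cd)))

cubeWitnessᵇ : ∀ {n} k → List (Vec Bool n) → Bool
cubeWitnessᵇ k images = distinctᵇ images ∧ all (λ ab → all (compatibleᵇ ab) pairing) pairing
  where
  pairing : List (Vec Bool k × Vec Bool _)
  pairing = zip (allVecs k) images

isCubeᵇ-intro : ∀ {k n} (S : List (Vec Bool n)) → length S ≡ 2 ^ k → CubeEmbedding k S → T (isCubeᵇ k S)
isCubeᵇ-intro {k} S len e =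
  Equivalence.from T-∧ (ℕ.≡⇒≡ᵇ _ _ len , any⁺ _ (lose images∈seqs (Equivalence.from T-∧ (distinct , compatible))))
  where
  open CubeEmbedding e
  images∈seqs : images ∈ seqs (2 ^ k) S
  images∈seqs = seqs⁺ (2 ^ k) S length-images (All.tabulate images⊆S)
  distinct : T (distinctᵇ images)
  distinct = Unique⇒distinctᵇ images images-unique
  graph : List (Vec Bool k × Vec Bool _)
  graph = map (λ a → a , embed a) (allVecs k)
  compatible-graph : ∀ {ab cd} → ab ∈ graph → cd ∈ graph → T (compatibleᵇ ab cd)
  compatible-graph ab∈ cd∈ with a , _ , refl ← ∈-map⁻ _ ab∈ | b , _ , refl ← ∈-map⁻ _ cd∈ =
    Equivalence.from (T-not-xorB⇔≡ _ _) (preserves-adj a b)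
  compatible : T (all (λ ab → all (compatibleᵇ ab) (zip (allVecs k) images)) (zip (allVecs k) images))
  compatible rewrite zip-map embed (allVecs k) =
    all⁻ _ (All.tabulate (λ ab∈ → all⁻ _ (All.tabulate (compatible-graph ab∈))))

T-all⇒∈ : ∀ {A : Set} (p : A → Bool) {xs x} → T (all p xs) → x ∈ xs → T (p x)
T-all⇒∈ p {xs} t = All.lookup (all⁺ p xs t)

isCubeᵇ-elim : ∀ {k n} (S : List (Vec Bool n)) → T (isCubeᵇ k S) → length S ≡ 2 ^ k × CubeEmbedding k S
isCubeᵇ-elim {k} {n} S t = ℕ.≡ᵇ⇒≡ (length S) (2 ^ k) (proj₁ parts) , record
  { embed         = embed
  ; injective     = λ {a} {b} fa≡fb →
      zip-injective (allVecs k) images (distinctᵇ⇒Unique images (proj₁ witness))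
                    (partner∈ a) (subst (λ y → (b , y) ∈ pairing) (sym fa≡fb) (partner∈ b))
  ; preserves-adj = λ a b →
      Equivalence.to (T-not-xorB⇔≡ _ _) (T-all⇒∈ _ (T-all⇒∈ _ (proj₂ witness) (partner∈ a)) (partner∈ b))
  ; embed-∈       = λ a → All.lookup (proj₂ shape) (∈-zip⁻ʳ (allVecs k) images (partner∈ a))
  }
  where
  parts : T (length S ≡ᵇ 2 ^ k) × T (any (cubeWitnessᵇ k) (seqs (2 ^ k) S))
  parts = Equivalence.to T-∧ t
  found : ∃[ images ] images ∈ seqs (2 ^ k) S × T (cubeWitnessᵇ k images)
  found = find (any⁻ (cubeWitnessᵇ k) (seqs (2 ^ k) S) (proj₂ parts))
  images : List (Vec Bool n)
  images = proj₁ found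
  shape : length images ≡ 2 ^ k × All (_∈ S) images
  shape = seqs⁻ (2 ^ k) S (proj₁ (proj₂ found))
  pairing : List (Vec Bool k × Vec Bool n)
  pairing = zip (allVecs k) images
  witness : T (distinctᵇ images) × T (all (λ ab → all (compatibleᵇ ab) pairing) pairing)
  witness = Equivalence.to T-∧ (proj₂ (proj₂ found))
  partner : ∀ a → ∃[ y ] (a , y) ∈ pairing
  partner a = zip-total (allVecs k) images (trans (length-allVecs k) (sym (proj₁ shape))) (∈-allVecs a)
  embed : Vec Bool k → Vec Bool n
  embed a = proj₁ (partner a)
  partner∈ : ∀ a → (a , embed a) ∈ pairing
  partner∈ a = proj₂ (partner a)

CubeEmbedding-surjective : ∀ {k n} {S : List (Vec Bool n)} → length S ≡ 2 ^ k → (e : CubeEmbedding k S) →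
                           ∀ {s} → s ∈ S → ∃[ a ] CubeEmbedding.embed e a ≡ s
CubeEmbedding-surjective {k} {S = S} len e s∈S =
  let a , _ , s≡ = ∈-map⁻ embed (Unique-⊆-length⇒⊇ (≡-dec Bool._≟_) images-unique images⊆S
                                   (ℕ.≤-reflexive (trans len (sym length-images))) s∈S)
  in a , sym s≡
  where open CubeEmbedding e

-- Cubes meeting both layers

insertAt-flipAt : ∀ {k} (b : Vec Bool k) (j : Fin (suc k)) x (i : Fin k) →
                  insertAt (flipAt i b) j x ≡ flipAt (punchIn j i) (insertAt b j x)
insertAt-flipAt b       fz     x i      = refl
insertAt-flipAt (y ∷ b) (fs j) x fz     = refl
insertAt-flipAt (y ∷ b) (fs j) x (fs i) = cong (y ∷_) (insertAt-flipAt b j x i)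

flipAt-insertAt : ∀ {k} (b : Vec Bool k) (j : Fin (suc k)) x → flipAt j (insertAt b j x) ≡ insertAt b j (not x)
flipAt-insertAt b       fz     x = refl
flipAt-insertAt (y ∷ b) (fs j) x = cong (y ∷_) (flipAt-insertAt b j x)

hamming-insertAt : ∀ {k} (b b′ : Vec Bool k) (j : Fin (suc k)) x →
                   hamming (insertAt b j x) (insertAt b′ j x) ≡ hamming b b′
hamming-insertAt b       b′        fz     true  = refl
hamming-insertAt b       b′        fz     false = refl
hamming-insertAt (y ∷ b) (y′ ∷ b′) (fs j) x     = cong (b2n (xorB y y′) +_) (hamming-insertAt b b′ j x)

hypercube-connected : ∀ {k} (P : Vec Bool k → Set) → (∀ a i → P a → P (flipAt i a)) → ∀ a b → P a → P b
hypercube-connected P closed []      []      Pa = Pa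
hypercube-connected P closed (x ∷ a) (y ∷ b) Pa =
  last-coordinate x y (hypercube-connected (λ v → P (x ∷ v)) (λ v i → closed (x ∷ v) (fs i)) a b Pa)
  where
  last-coordinate : ∀ x y → P (x ∷ b) → P (y ∷ b)
  last-coordinate true  true  P₁ = P₁
  last-coordinate false false P₁ = P₁
  last-coordinate true  false P₁ = closed _ fz P₁
  last-coordinate false true  P₁ = closed _ fz P₁

separating-edge : ∀ {k} (g : Vec Bool k → Bool) a b → g a ≢ g b → ∃[ c ] ∃[ j ] g c ≢ g (flipAt j c)
separating-edge g []      []      ga≢gb = ⊥-elim (ga≢gb refl)
separating-edge g (x ∷ a) (y ∷ b) ga≢gb with g (x ∷ a) Bool.≟ g (x ∷ b)
... | no ga≢gb′ = let c , j , sep = separating-edge (λ v → g (x ∷ v)) a b ga≢gb′ in x ∷ c , fs j , sep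
... | yes ga≡gb′ = first-coordinate x y (ga≢gb ∘ trans ga≡gb′)
  where
  first-coordinate : ∀ x y → g (x ∷ b) ≢ g (y ∷ b) → ∃[ c ] ∃[ j ] g c ≢ g (flipAt j c)
  first-coordinate true  true  sep = ⊥-elim (sep refl)
  first-coordinate false false sep = ⊥-elim (sep refl)
  first-coordinate true  false sep = true ∷ b , fz , sep
  first-coordinate false true  sep = false ∷ b , fz , sep

xorB-cancelˡ : ∀ a b → xorB a (xorB a b) ≡ b
xorB-cancelˡ true  b = not-involutive b
xorB-cancelˡ false b = refl

xorB-solve : ∀ a e x → xorB a e ≡ x → a ≡ xorB x e
xorB-solve true  true  _ refl = refl
xorB-solve true  false _ refl = refl
xorB-solve false true  _ refl = refl
xorB-solve false false _ refl = refl

xorB-self : ∀ a → xorB a a ≡ false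
xorB-self true  = refl
xorB-self false = refl

head-flipAt-fs : ∀ {n} (r : Fin n) (v : Vec Bool (suc n)) → head (flipAt (fs r) v) ≡ head v
head-flipAt-fs r (b ∷ v) = refl

head-flipAt-fz : ∀ {n} (v : Vec Bool (suc n)) → head (flipAt fz v) ≡ not (head v)
head-flipAt-fz (b ∷ v) = refl

module HeadDirection {k n} {S : List (Vec Bool (suc n))} (e : CubeEmbedding k S) where
  open CubeEmbedding e

  embed-Adjacent : ∀ a i → Adjacent (embed a) (embed (flipAt i a))
  embed-Adjacent a i = adjᵇ⇒Adjacent _ _ (subst T (preserves-adj a (flipAt i a)) (adjᵇ-flipAt i a))

  IsHeadDirection : Fin k → Set
  IsHeadDirection j = ∀ a → embed (flipAt j a) ≡ flipAt fz (embed a)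

  head-changing-edge : ∀ j c → head (embed c) ≢ head (embed (flipAt j c)) → embed (flipAt j c) ≡ flipAt fz (embed c)
  head-changing-edge j c changes with embed-Adjacent c j
  ... | fz   , eq = eq
  ... | fs r , eq = ⊥-elim (changes (sym (trans (cong head eq) (head-flipAt-fs r (embed c)))))

  -- The direction j ↦ 0 is transported along every edge by the 4-cycle through that edge.
  head-direction-rigid : ∀ j c → embed (flipAt j c) ≡ flipAt fz (embed c) → IsHeadDirection j
  head-direction-rigid j c at-c a = hypercube-connected (λ a → embed (flipAt j a) ≡ flipAt fz (embed a)) closed c a at-c
    where
    closed : ∀ a i → embed (flipAt j a) ≡ flipAt fz (embed a) → embed (flipAt j (flipAt i a)) ≡ flipAt fz (embed (flipAt i a))
    closed a i at-a with i ≟ᶠ j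
    ... | yes refl = trans (cong embed (flipAt-involutive i a))
                           (trans (sym (flipAt-involutive fz (embed a))) (cong (flipAt fz) (sym at-a)))
    ... | no i≢j with embed-Adjacent a i
    ... | s , fia≡ = trans (common-neighbour s fz (embed a) y s≢fz y~s y~fz y≢fa)
                           (trans (flipAt-comm s fz (embed a)) (cong (flipAt fz) (sym fia≡)))
      where
      y = embed (flipAt j (flipAt i a))
      s≢fz : s ≢ fz
      s≢fz refl = i≢j (flipAt-injectiveˡ i j a (injective (trans fia≡ (sym at-a))))
      y~s : Adjacent (flipAt s (embed a)) y
      y~s = subst (λ z → Adjacent z y) fia≡ (embed-Adjacent (flipAt i a) j)
      y~fz : Adjacent (flipAt fz (embed a)) y
      y~fz = subst₂ Adjacent at-a (cong embed (flipAt-comm i j a)) (embed-Adjacent (flipAt j a) i)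
      y≢fa : y ≢ embed a
      y≢fa y≡ = i≢j (flipAt-injectiveˡ i j a
                  (trans (sym (flipAt-involutive j (flipAt i a))) (cong (flipAt j) (injective y≡))))

  head-fixed : ∀ {j} → IsHeadDirection j → ∀ a i → i ≢ j → head (embed (flipAt i a)) ≡ head (embed a)
  head-fixed {j} dir a i i≢j with embed-Adjacent a i
  ... | fs r , eq = trans (cong head eq) (head-flipAt-fs r (embed a))
  ... | fz   , eq = ⊥-elim (i≢j (flipAt-injectiveˡ i j a (injective (trans eq (sym (dir a))))))

  head-embed : ∀ {j} → IsHeadDirection j → ∀ c a →
               head (embed a) ≡ xorB (lookup a j) (xorB (lookup c j) (head (embed c)))
  head-embed {j} dir c a =
    hypercube-connected (λ a → head (embed a) ≡ xorB (lookup a j) offset) closed c a (sym (xorB-cancelˡ (lookup c j) (head (embed c))))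
    where
    offset = xorB (lookup c j) (head (embed c))
    closed : ∀ a i → head (embed a) ≡ xorB (lookup a j) offset → head (embed (flipAt i a)) ≡ xorB (lookup (flipAt i a) j) offset
    closed a i eq with i ≟ᶠ j
    ... | yes refl = begin
      head (embed (flipAt i a))       ≡⟨ cong head (dir a) ⟩
      head (flipAt fz (embed a))      ≡⟨ head-flipAt-fz (embed a) ⟩
      not (head (embed a))            ≡⟨ cong not eq ⟩
      not (xorB (lookup a i) offset)  ≡⟨ not-xorB (lookup a i) offset ⟩
      xorB (not (lookup a i)) offset  ≡⟨ cong (λ b → xorB b offset) (lookup-flipAt i a) ⟨
      xorB (lookup (flipAt i a) i) offset ∎
      where
      open ≡-Reasoning
      not-xorB : ∀ a b → not (xorB a b) ≡ xorB (not a) b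
      not-xorB true  b = not-involutive b
      not-xorB false b = refl
    ... | no i≢j = trans (head-fixed dir a i i≢j) (trans eq (cong (λ b → xorB b offset) (sym (lookup-flipAt-≢ i j a i≢j))))

layers : ∀ {n} → List (Vec Bool n) → List (Vec Bool n) → List (Vec Bool (suc n))
layers V₀ V₁ = map (false ∷_) V₀ ++ map (true ∷_) V₁

module _ {n} {V₀ V₁ : List (Vec Bool n)} where

  ∈-layers⁺ˡ : ∀ {v} → v ∈ V₀ → (false ∷ v) ∈ layers V₀ V₁
  ∈-layers⁺ˡ v∈ = ∈-++⁺ˡ (∈-map⁺ (false ∷_) v∈)

  ∈-layers⁺ʳ : ∀ {v} → v ∈ V₁ → (true ∷ v) ∈ layers V₀ V₁
  ∈-layers⁺ʳ v∈ = ∈-++⁺ʳ (map (false ∷_) V₀) (∈-map⁺ (true ∷_) v∈)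

  ∈-layers⁻ : ∀ {b v} → (b ∷ v) ∈ layers V₀ V₁ → v ∈ (if b then V₁ else V₀)
  ∈-layers⁻ {b} {v} b∷v∈ with ∈-++⁻ (map (false ∷_) V₀) b∷v∈
  ... | inj₁ ∈V₀ with _ , v∈ , refl ← ∈-map⁻ (false ∷_) ∈V₀ = v∈
  ... | inj₂ ∈V₁ with _ , v∈ , refl ← ∈-map⁻ (true ∷_) ∈V₁ = v∈

  length-layers : length (layers V₀ V₁) ≡ length V₀ + length V₁
  length-layers = trans (length-++ (map (false ∷_) V₀)) (cong₂ _+_ (length-map _ V₀) (length-map _ V₁))

vec-η : ∀ {n} (v : Vec Bool (suc n)) → v ≡ head v ∷ tail v
vec-η (b ∷ v) = refl

module LowerEmbedding {k n} {V₀ V₁ : List (Vec Bool n)} (e : CubeEmbedding (suc k) (layers V₀ V₁))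
                      (j : Fin (suc k)) (c : Vec Bool (suc k)) (dir : HeadDirection.IsHeadDirection e j) where
  open CubeEmbedding e using (embed; injective; preserves-adj; embed-∈)
  open HeadDirection e using (head-embed)

  offset : Bool
  offset = xorB (lookup c j) (head (embed c))

  lower : Vec Bool k → Vec Bool n
  lower b = tail (embed (insertAt b j offset))

  embed-lower₀ : ∀ b → embed (insertAt b j offset) ≡ false ∷ lower b
  embed-lower₀ b = trans (vec-η _) (cong (_∷ lower b) (begin
    head (embed (insertAt b j offset))                    ≡⟨ head-embed dir c _ ⟩
    xorB (lookup (insertAt b j offset) j) offset          ≡⟨ cong (λ x → xorB x offset) (insertAt-lookup b j offset) ⟩
    xorB offset offset                                    ≡⟨ xorB-self offset ⟩
    false                                                 ∎))
    where open ≡-Reasoning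

  embed-lower₁ : ∀ b → embed (insertAt b j (not offset)) ≡ true ∷ lower b
  embed-lower₁ b = trans (cong embed (sym (flipAt-insertAt b j offset)))
                         (trans (dir _) (cong (flipAt fz) (embed-lower₀ b)))

  embed-preimage : ∀ a x → head (embed a) ≡ x → a ≡ insertAt (removeAt a j) j (xorB x offset)
  embed-preimage a x head≡x =
    trans (sym (insertAt-removeAt a j))
          (cong (insertAt (removeAt a j) j) (xorB-solve (lookup a j) offset x (trans (sym (head-embed dir c a)) head≡x)))

  lowerEmbedding : CubeEmbedding k V₀
  lowerEmbedding = record
    { embed         = lower
    ; injective     = λ {b} {b′} eq → begin
        b                                        ≡⟨ removeAt-insertAt b j offset ⟨
        removeAt (insertAt b j offset) j         ≡⟨ cong (λ a → removeAt a j) (injective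
                                                      (trans (embed-lower₀ b) (trans (cong (false ∷_) eq) (sym (embed-lower₀ b′))))) ⟩
        removeAt (insertAt b′ j offset) j        ≡⟨ removeAt-insertAt b′ j offset ⟩
        b′                                       ∎
    ; preserves-adj = λ b b′ → trans (cong (_≡ᵇ 1) (sym (hamming-insertAt b b′ j offset)))
                                     (trans (preserves-adj _ _) (cong₂ adjᵇ (embed-lower₀ b) (embed-lower₀ b′)))
    ; embed-∈       = λ b → ∈-layers⁻ (subst (_∈ layers V₀ V₁) (embed-lower₀ b) (embed-∈ _))
    }
    where open ≡-Reasoning

  module _ (len : length (layers V₀ V₁) ≡ 2 ^ suc k) where

    lower-covers₀ : ∀ {v} → v ∈ V₀ → ∃[ b ] lower b ≡ v
    lower-covers₀ v∈ with a , fa≡ ← CubeEmbedding-surjective len e (∈-layers⁺ˡ v∈) =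
      removeAt a j , cong tail (trans (cong embed (sym (embed-preimage a false (cong head fa≡)))) fa≡)

    lower-covers₁ : ∀ {v} → v ∈ V₁ → ∃[ b ] lower b ≡ v
    lower-covers₁ v∈ with a , fa≡ ← CubeEmbedding-surjective len e (∈-layers⁺ʳ v∈) =
      removeAt a j , cong tail (trans (sym (embed-lower₁ _))
                                      (trans (cong embed (sym (embed-preimage a true (cong head fa≡)))) fa≡))

    V₀⊆V₁ : V₀ ⊆ V₁
    V₀⊆V₁ v∈ with b , refl ← lower-covers₀ v∈ =
      ∈-layers⁻ (subst (_∈ layers V₀ V₁) (embed-lower₁ b) (embed-∈ _))

    V₁⊆V₀ : V₁ ⊆ V₀
    V₁⊆V₀ v∈ with b , refl ← lower-covers₁ v∈ = CubeEmbedding.embed-∈ lowerEmbedding b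

    length-V₀ : Unique V₀ → length V₀ ≡ 2 ^ k
    length-V₀ u₀ = ℕ.≤-antisym
      (subst (length V₀ ≤_) length-images (Unique⇒length-≤ u₀ V₀⊆images))
      (subst (_≤ length V₀) length-images (Unique⇒length-≤ images-unique images⊆S))
      where
      open CubeEmbedding lowerEmbedding using (images; images-unique; images⊆S; length-images)
      V₀⊆images : V₀ ⊆ images
      V₀⊆images v∈ with b , refl ← lower-covers₀ v∈ = ∈-map⁺ lower (∈-allVecs b)

straddling-cube : ∀ {k n} {V₀ V₁ : List (Vec Bool n)} {v₀ v₁} → Unique V₀ → v₀ ∈ V₀ → v₁ ∈ V₁ →
                  T (isCubeᵇ k (layers V₀ V₁)) → ∃[ k′ ] k ≡ suc k′ × V₀ ⊆ V₁ × V₁ ⊆ V₀ × T (isCubeᵇ k′ V₀)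
straddling-cube {k} {V₀ = V₀} {V₁} {v₀} {v₁} u₀ v₀∈ v₁∈ cube =
  let len , e = isCubeᵇ-elim {k} (layers V₀ V₁) cube in by-dimension k len e
  where
  by-dimension : ∀ k → length (layers V₀ V₁) ≡ 2 ^ k → (e : CubeEmbedding k (layers V₀ V₁)) →
                 ∃[ k′ ] k ≡ suc k′ × V₀ ⊆ V₁ × V₁ ⊆ V₀ × T (isCubeᵇ k′ V₀)
  by-dimension zero len e
    with [] , fa₀≡ ← CubeEmbedding-surjective len e (∈-layers⁺ˡ v₀∈)
    with [] , fa₁≡ ← CubeEmbedding-surjective len e (∈-layers⁺ʳ v₁∈)
    with () ← cong head (trans (sym fa₀≡) fa₁≡)
  by-dimension (suc k′) len e =
    k′ , refl , V₀⊆V₁ len , V₁⊆V₀ len , isCubeᵇ-intro V₀ (length-V₀ len u₀) lowerEmbedding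
    where
    open CubeEmbedding e using (embed)
    open HeadDirection e using (head-changing-edge; head-direction-rigid)
    preimage₀ : ∃[ a ] embed a ≡ false ∷ v₀
    preimage₀ = CubeEmbedding-surjective len e (∈-layers⁺ˡ v₀∈)
    preimage₁ : ∃[ a ] embed a ≡ true ∷ v₁
    preimage₁ = CubeEmbedding-surjective len e (∈-layers⁺ʳ v₁∈)
    heads-differ : head (embed (proj₁ preimage₀)) ≢ head (embed (proj₁ preimage₁))
    heads-differ eq with () ← trans (sym (cong head (proj₂ preimage₀))) (trans eq (cong head (proj₂ preimage₁)))
    edge : ∃[ c ] ∃[ j ] head (embed c) ≢ head (embed (flipAt j c))
    edge = separating-edge (head ∘ embed) _ _ heads-differ
    c : Vec Bool (suc k′)
    c = proj₁ edge
    j : Fin (suc k′)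
    j = proj₁ (proj₂ edge)
    open LowerEmbedding {V₀ = V₀} {V₁} e j c (head-direction-rigid j c (head-changing-edge j c (proj₂ (proj₂ edge))))

doubled-cube : ∀ {k n} (V : List (Vec Bool n)) → T (isCubeᵇ k V) → T (isCubeᵇ (suc k) (layers V V))
doubled-cube {k} V cube = isCubeᵇ-intro (layers V V) length-doubled (record
  { embed         = doubled
  ; injective     = λ { {x ∷ a} {y ∷ b} eq → cong₂ _∷_ (cong head eq) (injective (cong tail eq)) }
  ; preserves-adj = doubled-adj
  ; embed-∈       = λ { (false ∷ a) → ∈-layers⁺ˡ (embed-∈ a) ; (true ∷ a) → ∈-layers⁺ʳ (embed-∈ a) }
  })
  where
  len : length V ≡ 2 ^ k
  len = proj₁ (isCubeᵇ-elim {k} V cube)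
  open CubeEmbedding (proj₂ (isCubeᵇ-elim {k} V cube))
  doubled : Vec Bool (suc k) → Vec Bool (suc _)
  doubled (x ∷ a) = x ∷ embed a
  eqᵇ-injective : ∀ a b → eqᵇ a b ≡ eqᵇ (embed a) (embed b)
  eqᵇ-injective a b = T-ext (λ t → subst (λ z → T (eqᵇ z (embed b))) (cong embed (sym (eqᵇ⇒≡ a b t))) (eqᵇ-refl (embed b)))
                            (λ t → subst (λ z → T (eqᵇ z b)) (sym (injective (eqᵇ⇒≡ _ _ t))) (eqᵇ-refl b))
  -- Across the two layers, adjᵇ (b ∷ u) (not b ∷ v) computes to eqᵇ u v.
  doubled-adj : ∀ a b → adjᵇ a b ≡ adjᵇ (doubled a) (doubled b)
  doubled-adj (false ∷ a) (false ∷ b) = preserves-adj a b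
  doubled-adj (true ∷ a)  (true ∷ b)  = preserves-adj a b
  doubled-adj (false ∷ a) (true ∷ b)  = eqᵇ-injective a b
  doubled-adj (true ∷ a)  (false ∷ b) = eqᵇ-injective a b
  length-doubled : length (layers V V) ≡ 2 ^ suc k
  length-doubled = trans (length-layers {V₀ = V} {V}) (trans (cong₂ _+_ len len) (cong (2 ^ k +_) (sym (ℕ.+-identityʳ (2 ^ k)))))

-- Counting vertex sets

𝟙 : Bool → ℕ
𝟙 true  = 1
𝟙 false = 0

module _ {A : Set} where

  sumOver : (A → ℕ) → List A → ℕ
  sumOver f []       = 0
  sumOver f (x ∷ xs) = f x + sumOver f xs

  length-filterᵇ : ∀ (P : A → Bool) xs → length (filterᵇ P xs) ≡ sumOver (𝟙 ∘ P) xs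
  length-filterᵇ P []       = refl
  length-filterᵇ P (x ∷ xs) with P x
  ... | true  = cong suc (length-filterᵇ P xs)
  ... | false = length-filterᵇ P xs

  sumOver-++ : ∀ f (xs ys : List A) → sumOver f (xs ++ ys) ≡ sumOver f xs + sumOver f ys
  sumOver-++ f []       ys = refl
  sumOver-++ f (x ∷ xs) ys = trans (cong (f x +_) (sumOver-++ f xs ys)) (sym (ℕ.+-assoc (f x) _ _))

  sumOver-cong : ∀ {f g} (xs : List A) → (∀ {x} → x ∈ xs → f x ≡ g x) → sumOver f xs ≡ sumOver g xs
  sumOver-cong []       f≡g = refl
  sumOver-cong (x ∷ xs) f≡g = cong₂ _+_ (f≡g (here refl)) (sumOver-cong xs (f≡g ∘ there))

  sumOver-zero : ∀ {f} (xs : List A) → (∀ {x} → x ∈ xs → f x ≡ 0) → sumOver f xs ≡ 0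
  sumOver-zero []       f≡0 = refl
  sumOver-zero (x ∷ xs) f≡0 = cong₂ _+_ (f≡0 (here refl)) (sumOver-zero xs (f≡0 ∘ there))

  sumOver-+ : ∀ f g (xs : List A) → sumOver (λ x → f x + g x) xs ≡ sumOver f xs + sumOver g xs
  sumOver-+ f g []       = refl
  sumOver-+ f g (x ∷ xs) = trans (cong (f x + g x +_) (sumOver-+ f g xs)) (+-interchange (f x) (g x) _ _)

  sumOver-*ʳ : ∀ f c (xs : List A) → sumOver (λ x → f x * c) xs ≡ sumOver f xs * c
  sumOver-*ʳ f c []       = refl
  sumOver-*ʳ f c (x ∷ xs) = trans (cong (f x * c +_) (sumOver-*ʳ f c xs)) (sym (ℕ.*-distribʳ-+ c (f x) _))

module _ {A B : Set} where

  sumOver-map : ∀ f (g : A → B) xs → sumOver f (map g xs) ≡ sumOver (f ∘ g) xs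
  sumOver-map f g []       = refl
  sumOver-map f g (x ∷ xs) = cong (f (g x) +_) (sumOver-map f g xs)

  sumOver-comm : ∀ (f : A → B → ℕ) xs ys →
                 sumOver (λ x → sumOver (f x) ys) xs ≡ sumOver (λ y → sumOver (λ x → f x y) xs) ys
  sumOver-comm f []       ys = sym (sumOver-zero ys (λ _ → refl))
  sumOver-comm f (x ∷ xs) ys = trans (cong (sumOver (f x) ys +_) (sumOver-comm f xs ys)) (sym (sumOver-+ (f x) _ ys))

  sumOver-concatMap : ∀ f (g : A → List B) xs → sumOver f (concatMap g xs) ≡ sumOver (sumOver f ∘ g) xs
  sumOver-concatMap f g []       = refl
  sumOver-concatMap f g (x ∷ xs) = trans (sumOver-++ f (g x) _) (cong (sumOver f (g x) +_) (sumOver-concatMap f g xs))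

module _ {A : Set} where

  ∈-subsets⁻ : ∀ (x : A) xs {T} → T ∈ subsets (x ∷ xs) →
               (∃[ T′ ] T′ ∈ subsets xs × T ≡ x ∷ T′) ⊎ T ∈ subsets xs
  ∈-subsets⁻ x xs T∈ with ∈-++⁻ (map (x ∷_) (subsets xs)) T∈
  ... | inj₁ T∈₁ = inj₁ (∈-map⁻ (x ∷_) T∈₁)
  ... | inj₂ T∈₂ = inj₂ T∈₂

  ∈-subsets⁺ˡ : ∀ (x : A) xs {T} → T ∈ subsets xs → (x ∷ T) ∈ subsets (x ∷ xs)
  ∈-subsets⁺ˡ x xs T∈ = ∈-++⁺ˡ (∈-map⁺ _ T∈)

  ∈-subsets⁺ʳ : ∀ (x : A) xs {T} → T ∈ subsets xs → T ∈ subsets (x ∷ xs)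
  ∈-subsets⁺ʳ x xs T∈ = ∈-++⁺ʳ (map (x ∷_) (subsets xs)) T∈

  []∈subsets : ∀ (xs : List A) → [] ∈ subsets xs
  []∈subsets []       = here refl
  []∈subsets (x ∷ xs) = ∈-subsets⁺ʳ x xs ([]∈subsets xs)

  ∈-subsets⇒⊆ : ∀ (xs : List A) {T} → T ∈ subsets xs → T ⊆ xs
  ∈-subsets⇒⊆ []       (here refl) ()
  ∈-subsets⇒⊆ (x ∷ xs) T∈ z∈ with ∈-subsets⁻ x xs T∈
  ... | inj₂ T∈′                 = there (∈-subsets⇒⊆ xs T∈′ z∈)
  ... | inj₁ (T′ , T′∈ , refl) with z∈
  ...   | here z≡x  = here z≡x
  ...   | there z∈′ = there (∈-subsets⇒⊆ xs T′∈ z∈′)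

  subsets-unique : ∀ {xs : List A} → Unique xs → Unique (subsets xs)
  subsets-unique []                    = [] ∷ []
  subsets-unique {x ∷ xs} (x∉xs ∷ u) =
    Unique.++⁺ (Unique.map⁺ (proj₂ ∘ ∷-injective) (subsets-unique u)) (subsets-unique u) disjoint
    where
    disjoint : ∀ {T} → ¬ (T ∈ map (x ∷_) (subsets xs) × T ∈ subsets xs)
    disjoint (T∈₁ , T∈₂) with _ , _ , refl ← ∈-map⁻ (x ∷_) T∈₁ =
      All.lookup x∉xs (∈-subsets⇒⊆ xs T∈₂ (here refl)) refl

  ∈-subsets-filterᵇ : ∀ (P : A → Bool) xs {U} → U ∈ subsets (filterᵇ P xs) → U ∈ subsets xs
  ∈-subsets-filterᵇ P []       U∈ = U∈
  ∈-subsets-filterᵇ P (x ∷ xs) U∈ with P x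
  ... | false = ∈-subsets⁺ʳ x xs (∈-subsets-filterᵇ P xs U∈)
  ... | true with ∈-subsets⁻ x (filterᵇ P xs) U∈
  ...   | inj₁ (U′ , U′∈ , refl) = ∈-subsets⁺ˡ x xs (∈-subsets-filterᵇ P xs U′∈)
  ...   | inj₂ U∈′               = ∈-subsets⁺ʳ x xs (∈-subsets-filterᵇ P xs U∈′)

  -- Subsets are listed in the order of xs, so equal members force equal lists.
  subsets-⊆-antisym : ∀ {xs : List A} {T U} → Unique xs → T ∈ subsets xs → U ∈ subsets xs → T ⊆ U → U ⊆ T → T ≡ U
  subsets-⊆-antisym {[]} _ (here refl) (here refl) _ _ = refl
  subsets-⊆-antisym {x ∷ xs} (x∉xs ∷ u) T∈ U∈ T⊆U U⊆T with ∈-subsets⁻ x xs T∈ | ∈-subsets⁻ x xs U∈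
  ... | inj₁ (T′ , T′∈ , refl) | inj₁ (U′ , U′∈ , refl) =
    cong (x ∷_) (subsets-⊆-antisym u T′∈ U′∈ (λ z∈ → drop-x (∈-subsets⇒⊆ xs T′∈ z∈) (T⊆U (there z∈)))
                                              (λ z∈ → drop-x (∈-subsets⇒⊆ xs U′∈ z∈) (U⊆T (there z∈))))
    where
    drop-x : ∀ {z W} → z ∈ xs → z ∈ x ∷ W → z ∈ W
    drop-x z∈xs (here refl) = ⊥-elim (All.lookup x∉xs z∈xs refl)
    drop-x z∈xs (there z∈)  = z∈
  ... | inj₁ (T′ , T′∈ , refl) | inj₂ U∈′ = ⊥-elim (All.lookup x∉xs (∈-subsets⇒⊆ xs U∈′ (T⊆U (here refl))) refl)
  ... | inj₂ T∈′ | inj₁ (U′ , U′∈ , refl) = ⊥-elim (All.lookup x∉xs (∈-subsets⇒⊆ xs T∈′ (U⊆T (here refl))) refl)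
  ... | inj₂ T∈′ | inj₂ U∈′               = subsets-⊆-antisym u T∈′ U∈′ T⊆U U⊆T

  count-≡ : (_≟_ : DecidableEquality A) → ∀ {L U} → Unique L → U ∈ L → sumOver (λ T → 𝟙 (does (T ≟ U))) L ≡ 1
  count-≡ _≟_ {x ∷ L} {U} (x∉L ∷ u) (here refl) with x ≟ x
  ... | yes _   = cong suc (sumOver-zero L (λ {T} T∈ → absent T T∈))
    where
    absent : ∀ T → T ∈ L → 𝟙 (does (T ≟ x)) ≡ 0
    absent T T∈ with T ≟ x
    ... | yes refl = ⊥-elim (All.lookup x∉L T∈ refl)
    ... | no  _    = refl
  ... | no  x≢x = ⊥-elim (x≢x refl)
  count-≡ _≟_ {x ∷ L} {U} (x∉L ∷ u) (there U∈) with x ≟ U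
  ... | yes refl = ⊥-elim (All.lookup x∉L U∈ refl)
  ... | no  _    = count-≡ _≟_ u U∈

module _ {A B : Set} where

  subsets-map : ∀ (g : A → B) xs → subsets (map g xs) ≡ map (map g) (subsets xs)
  subsets-map g []       = refl
  subsets-map g (x ∷ xs) = begin
    map (g x ∷_) (subsets (map g xs)) ++ subsets (map g xs)
      ≡⟨ cong (λ r → map (g x ∷_) r ++ r) (subsets-map g xs) ⟩
    map (g x ∷_) (map (map g) (subsets xs)) ++ map (map g) (subsets xs)
      ≡⟨ cong (_++ map (map g) (subsets xs)) (trans (sym (map-∘ (subsets xs))) (map-∘ (subsets xs))) ⟩
    map (map g) (map (x ∷_) (subsets xs)) ++ map (map g) (subsets xs)
      ≡⟨ map-++ (map g) (map (x ∷_) (subsets xs)) (subsets xs) ⟨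
    map (map g) (map (x ∷_) (subsets xs) ++ subsets xs) ∎
    where open ≡-Reasoning

subsets-++ : ∀ {A : Set} (xs ys : List A) → subsets (xs ++ ys) ≡ concatMap (λ T → map (T ++_) (subsets ys)) (subsets xs)
subsets-++ []       ys = sym (trans (++-identityʳ _) (map-id (subsets ys)))
subsets-++ (x ∷ xs) ys = begin
  map (x ∷_) (subsets (xs ++ ys)) ++ subsets (xs ++ ys)
    ≡⟨ cong (λ r → map (x ∷_) r ++ r) (subsets-++ xs ys) ⟩
  map (x ∷_) (concatMap F (subsets xs)) ++ concatMap F (subsets xs)
    ≡⟨ cong (_++ concatMap F (subsets xs))
            (trans (concatMap-map F (x ∷_) (subsets xs))
                   (trans (concatMap-cong (λ T → map-∘ (subsets ys)) (subsets xs))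
                          (sym (map-concatMap (x ∷_) F (subsets xs))))) ⟨
  concatMap F (map (x ∷_) (subsets xs)) ++ concatMap F (subsets xs)
    ≡⟨ concatMap-++ F (map (x ∷_) (subsets xs)) (subsets xs) ⟨
  concatMap F (map (x ∷_) (subsets xs) ++ subsets xs) ∎
  where
  open ≡-Reasoning
  F : List _ → List (List _)
  F T = map (T ++_) (subsets ys)

countSubsets : ∀ {A : Set} → (List A → Bool) → List A → ℕ
countSubsets P L = sumOver (𝟙 ∘ P) (subsets L)

PermutationInvariant : ∀ {A : Set} → (List A → Bool) → Set
PermutationInvariant P = ∀ {S S′} → S ↭ S′ → P S ≡ P S′

module _ {A : Set} where

  countSubsets-∷ : ∀ (P : List A → Bool) x xs → countSubsets P (x ∷ xs) ≡ countSubsets (P ∘ (x ∷_)) xs + countSubsets P xs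
  countSubsets-∷ P x xs = trans (sumOver-++ _ (map (x ∷_) (subsets xs)) (subsets xs))
                                (cong (_+ countSubsets P xs) (sumOver-map _ (x ∷_) (subsets xs)))

  countSubsets-↭ : ∀ {P : List A → Bool} → PermutationInvariant P → ∀ {L L′} → L ↭ L′ → countSubsets P L ≡ countSubsets P L′
  countSubsets-↭ inv ↭.refl = refl
  countSubsets-↭ {P} inv (↭.prep {xs} {ys} x L↭L′) =
    trans (countSubsets-∷ P x xs)
          (trans (cong₂ _+_ (countSubsets-↭ (inv ∘ ↭.prep x) L↭L′) (countSubsets-↭ inv L↭L′))
                 (sym (countSubsets-∷ P x ys)))
  countSubsets-↭ {P} inv (↭.swap {xs} {ys} x y L↭L′) = begin
    countSubsets P (x ∷ y ∷ xs)
      ≡⟨ expand x y xs ⟩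
    (countSubsets (P ∘ (x ∷_) ∘ (y ∷_)) xs + countSubsets (P ∘ (x ∷_)) xs) + (countSubsets (P ∘ (y ∷_)) xs + countSubsets P xs)
      ≡⟨ +-interchange (countSubsets (P ∘ (x ∷_) ∘ (y ∷_)) xs) (countSubsets (P ∘ (x ∷_)) xs) _ _ ⟩
    (countSubsets (P ∘ (x ∷_) ∘ (y ∷_)) xs + countSubsets (P ∘ (y ∷_)) xs) + (countSubsets (P ∘ (x ∷_)) xs + countSubsets P xs)
      ≡⟨ cong₂ _+_ (cong₂ _+_ xy≡yx (countSubsets-↭ (inv ∘ ↭.prep y) L↭L′))
                   (cong₂ _+_ (countSubsets-↭ (inv ∘ ↭.prep x) L↭L′) (countSubsets-↭ inv L↭L′)) ⟩
    (countSubsets (P ∘ (y ∷_) ∘ (x ∷_)) ys + countSubsets (P ∘ (y ∷_)) ys) + (countSubsets (P ∘ (x ∷_)) ys + countSubsets P ys)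
      ≡⟨ expand y x ys ⟨
    countSubsets P (y ∷ x ∷ ys) ∎
    where
    open ≡-Reasoning
    expand : ∀ x y xs → countSubsets P (x ∷ y ∷ xs) ≡
             (countSubsets (P ∘ (x ∷_) ∘ (y ∷_)) xs + countSubsets (P ∘ (x ∷_)) xs) + (countSubsets (P ∘ (y ∷_)) xs + countSubsets P xs)
    expand x y xs = trans (countSubsets-∷ P x (y ∷ xs)) (cong₂ _+_ (countSubsets-∷ (P ∘ (x ∷_)) y xs) (countSubsets-∷ P y xs))
    xy≡yx : countSubsets (P ∘ (x ∷_) ∘ (y ∷_)) xs ≡ countSubsets (P ∘ (y ∷_) ∘ (x ∷_)) ys
    xy≡yx = trans (countSubsets-↭ (inv ∘ ↭.prep x ∘ ↭.prep y) L↭L′)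
                  (sumOver-cong (subsets ys) (λ _ → cong 𝟙 (inv (↭.swap x y ↭.refl))))
  countSubsets-↭ inv (↭.trans L↭L″ L″↭L′) = trans (countSubsets-↭ inv L↭L″) (countSubsets-↭ inv L″↭L′)

isCubeAtᵇ : ∀ {n} → ℕ → ℕ → List (Vec Bool n) → Bool
isCubeAtᵇ k d S = isCubeᵇ k S ∧ (minWeight S ≡ᵇ d)

isCubeᵇ-⊆ : ∀ {k n} {S S′ : List (Vec Bool n)} → length S ≡ length S′ → S ⊆ S′ → T (isCubeᵇ k S) → T (isCubeᵇ k S′)
isCubeᵇ-⊆ {k} {S = S} {S′} len S⊆S′ cube =
  isCubeᵇ-intro S′ (trans (sym len) (proj₁ elim)) (record
    { embed = embed ; injective = injective ; preserves-adj = preserves-adj ; embed-∈ = S⊆S′ ∘ embed-∈ })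
  where
  elim : length S ≡ 2 ^ k × CubeEmbedding k S
  elim = isCubeᵇ-elim {k} S cube
  open CubeEmbedding (proj₂ elim)

minWeight-≤ : ∀ {n} (S : List (Vec Bool n)) {s} → s ∈ S → minWeight S ≤ weight s
minWeight-≤ (v ∷ [])     (here refl) = ℕ.≤-refl
minWeight-≤ (v ∷ w ∷ ws) (here refl) = ℕ.m⊓n≤m (weight v) _
minWeight-≤ (v ∷ w ∷ ws) (there s∈) = ℕ.≤-trans (ℕ.m⊓n≤n (weight v) _) (minWeight-≤ (w ∷ ws) s∈)

minWeight-attained : ∀ {n} v (S : List (Vec Bool n)) → ∃[ s ] s ∈ v ∷ S × minWeight (v ∷ S) ≡ weight s
minWeight-attained v []       = v , here refl , refl
minWeight-attained v (w ∷ ws) with s , s∈ , eq ← minWeight-attained w ws with weight v ℕ.≤? minWeight (w ∷ ws)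
... | yes v≤ = v , here refl , ℕ.m≤n⇒m⊓n≡m v≤
... | no  v≰ = s , there s∈ , trans (ℕ.m≥n⇒m⊓n≡n (ℕ.≰⇒≥ v≰)) eq

minWeight-⊆-antisym : ∀ {n} (S S′ : List (Vec Bool n)) → S ⊆ S′ → S′ ⊆ S → minWeight S ≡ minWeight S′
minWeight-⊆-antisym []      []        _    _    = refl
minWeight-⊆-antisym []      (v′ ∷ S′) _    S′⊆S with () ← S′⊆S (here refl)
minWeight-⊆-antisym (v ∷ S) []        S⊆S′ _    with () ← S⊆S′ (here refl)
minWeight-⊆-antisym (v ∷ S) (v′ ∷ S′) S⊆S′ S′⊆S
  with s , s∈ , eq ← minWeight-attained v S | s′ , s′∈ , eq′ ← minWeight-attained v′ S′ = ℕ.≤-antisym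
    (subst (_ ≤_) (sym eq′) (minWeight-≤ (v ∷ S) (S′⊆S s′∈)))
    (subst (_ ≤_) (sym eq) (minWeight-≤ (v′ ∷ S′) (S⊆S′ s∈)))

isCubeAtᵇ-↭ : ∀ {n} k d → PermutationInvariant (isCubeAtᵇ {n} k d)
isCubeAtᵇ-↭ k d {S} {S′} S↭S′ = cong₂ _∧_
  (T-ext (isCubeᵇ-⊆ {k} (↭-length S↭S′) (∈-resp-↭ S↭S′)) (isCubeᵇ-⊆ {k} (sym (↭-length S↭S′)) (∈-resp-↭ (↭.↭-sym S↭S′))))
  (cong (_≡ᵇ d) (minWeight-⊆-antisym S S′ (∈-resp-↭ S↭S′) (∈-resp-↭ (↭.↭-sym S↭S′))))

isCubeAtᵇ-length : ∀ {k n} d {S : List (Vec Bool n)} → length S ≢ 2 ^ k → isCubeAtᵇ k d S ≡ false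
isCubeAtᵇ-length {k} d {S} len≢ =
  T-ext (λ t → len≢ (proj₁ (isCubeᵇ-elim {k} S (proj₁ (Equivalence.to T-∧ t))))) (λ ())

isCubeAtᵇ-[] : ∀ {n} k d → isCubeAtᵇ {n} k d [] ≡ false
isCubeAtᵇ-[] k d = isCubeAtᵇ-length {k} d {[]} (ℕ.<⇒≢ (ℕ.m^n>0 2 k))

adjᵇ-∷ : ∀ {n} b (u v : Vec Bool n) → adjᵇ (b ∷ u) (b ∷ v) ≡ adjᵇ u v
adjᵇ-∷ true  u v = refl
adjᵇ-∷ false u v = refl

isCubeᵇ-map-∷ : ∀ {k n} b (V : List (Vec Bool n)) → isCubeᵇ k (map (b ∷_) V) ≡ isCubeᵇ k V
isCubeᵇ-map-∷ {k} b V = T-ext drop-prefix add-prefix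
  where
  add-prefix : T (isCubeᵇ k V) → T (isCubeᵇ k (map (b ∷_) V))
  add-prefix cube = isCubeᵇ-intro (map (b ∷_) V) (trans (length-map _ V) len) (record
    { embed         = λ a → b ∷ embed a
    ; injective     = injective ∘ cong tail
    ; preserves-adj = λ a a′ → trans (preserves-adj a a′) (sym (adjᵇ-∷ b (embed a) (embed a′)))
    ; embed-∈       = ∈-map⁺ (b ∷_) ∘ embed-∈
    })
    where
    len : length V ≡ 2 ^ k
    len = proj₁ (isCubeᵇ-elim {k} V cube)
    open CubeEmbedding (proj₂ (isCubeᵇ-elim {k} V cube))
  drop-prefix : T (isCubeᵇ k (map (b ∷_) V)) → T (isCubeᵇ k V)
  drop-prefix cube = isCubeᵇ-intro V (trans (sym (length-map _ V)) len) (record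
    { embed         = tail ∘ embed
    ; injective     = λ {a} {a′} eq → injective (trans (prefixed a) (trans (cong (b ∷_) eq) (sym (prefixed a′))))
    ; preserves-adj = λ a a′ → trans (preserves-adj a a′)
                                     (trans (cong₂ adjᵇ (prefixed a) (prefixed a′)) (adjᵇ-∷ b (tail (embed a)) (tail (embed a′))))
    ; embed-∈       = λ a → let t , t∈ , eq = ∈-map⁻ (b ∷_) (embed-∈ a) in subst (_∈ V) (sym (cong tail eq)) t∈
    })
    where
    len : length (map (b ∷_) V) ≡ 2 ^ k
    len = proj₁ (isCubeᵇ-elim {k} (map (b ∷_) V) cube)
    open CubeEmbedding (proj₂ (isCubeᵇ-elim {k} (map (b ∷_) V) cube))
    prefixed : ∀ a → embed a ≡ b ∷ tail (embed a)
    prefixed a = let _ , _ , eq = ∈-map⁻ (b ∷_) (embed-∈ a) in trans eq (cong (λ z → b ∷ tail z) (sym eq))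

minWeight-map-false : ∀ {n} (V : List (Vec Bool n)) → minWeight (map (false ∷_) V) ≡ minWeight V
minWeight-map-false []           = refl
minWeight-map-false (v ∷ [])     = refl
minWeight-map-false (v ∷ w ∷ ws) = cong (weight v ⊓_) (minWeight-map-false (w ∷ ws))

minWeight-map-true : ∀ {n} v (V : List (Vec Bool n)) → minWeight (map (true ∷_) (v ∷ V)) ≡ suc (minWeight (v ∷ V))
minWeight-map-true v []       = refl
minWeight-map-true v (w ∷ ws) = cong (suc (weight v) ⊓_) (minWeight-map-true w ws)

minWeight-++ : ∀ {n} v (V : List (Vec Bool n)) w W → minWeight ((v ∷ V) ++ (w ∷ W)) ≡ minWeight (v ∷ V) ⊓ minWeight (w ∷ W)
minWeight-++ v []       w W = refl
minWeight-++ v (v′ ∷ V) w W = trans (cong (weight v ⊓_) (minWeight-++ v′ V w W)) (sym (ℕ.⊓-assoc (weight v) _ _))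

minWeight-layers-self : ∀ {n} v (V : List (Vec Bool n)) → minWeight (layers (v ∷ V) (v ∷ V)) ≡ minWeight (v ∷ V)
minWeight-layers-self v V =
  trans (minWeight-++ (false ∷ v) (map (false ∷_) V) (true ∷ v) (map (true ∷_) V))
        (trans (cong₂ _⊓_ (minWeight-map-false (v ∷ V)) (minWeight-map-true v V)) (ℕ.m≤n⇒m⊓n≡m (ℕ.n≤1+n _)))

isCubeAtᵇ-map-false : ∀ {n} k d (V : List (Vec Bool n)) → isCubeAtᵇ k d (map (false ∷_) V) ≡ isCubeAtᵇ k d V
isCubeAtᵇ-map-false k d V = cong₂ _∧_ (isCubeᵇ-map-∷ {k} false V) (cong (_≡ᵇ d) (minWeight-map-false V))

isCubeAtᵇ-predWeight : ∀ {n} → ℕ → ℕ → List (Vec Bool n) → Bool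
isCubeAtᵇ-predWeight k zero    V = false
isCubeAtᵇ-predWeight k (suc d) V = isCubeAtᵇ k d V

isCubeAtᵇ-predDim : ∀ {n} → ℕ → ℕ → List (Vec Bool n) → Bool
isCubeAtᵇ-predDim zero    d V = false
isCubeAtᵇ-predDim (suc k) d V = isCubeAtᵇ k d V

isCubeAtᵇ-predWeight-[] : ∀ {n} k d → isCubeAtᵇ-predWeight {n} k d [] ≡ false
isCubeAtᵇ-predWeight-[] k zero    = refl
isCubeAtᵇ-predWeight-[] k (suc d) = isCubeAtᵇ-[] k d

isCubeAtᵇ-predDim-[] : ∀ {n} k d → isCubeAtᵇ-predDim {n} k d [] ≡ false
isCubeAtᵇ-predDim-[] zero    d = refl
isCubeAtᵇ-predDim-[] (suc k) d = isCubeAtᵇ-[] k d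

isCubeAtᵇ-map-true : ∀ {n} k d v (V : List (Vec Bool n)) →
                     isCubeAtᵇ k d (map (true ∷_) (v ∷ V)) ≡ isCubeAtᵇ-predWeight k d (v ∷ V)
isCubeAtᵇ-map-true k zero    v V rewrite isCubeᵇ-map-∷ {k} true (v ∷ V) | minWeight-map-true v V = Bool.∧-zeroʳ _
isCubeAtᵇ-map-true k (suc d) v V rewrite isCubeᵇ-map-∷ {k} true (v ∷ V) | minWeight-map-true v V = refl

∈-subsets⇒Unique : ∀ {A : Set} {xs : List A} {T} → Unique xs → T ∈ subsets xs → Unique T
∈-subsets⇒Unique {xs = []}     _           (here refl) = []
∈-subsets⇒Unique {xs = x ∷ xs} (x∉xs ∷ u) T∈ with ∈-subsets⁻ x xs T∈
... | inj₂ T∈′                 = ∈-subsets⇒Unique u T∈′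
... | inj₁ (T′ , T′∈ , refl) =
  All.tabulate (λ z∈ x≡z → All.lookup x∉xs (∈-subsets⇒⊆ xs T′∈ z∈) x≡z) ∷ ∈-subsets⇒Unique u T′∈

_≟ᴸ_ : ∀ {n} → DecidableEquality (List (Vec Bool n))
_≟ᴸ_ = List.≡-dec (≡-dec Bool._≟_)

𝟙-∧ : ∀ a b → 𝟙 (a ∧ b) ≡ 𝟙 a * 𝟙 b
𝟙-∧ true  b = sym (ℕ.+-identityʳ (𝟙 b))
𝟙-∧ false b = refl

T-does⁺ : ∀ {P : Set} (p? : Dec P) → P → T (does p?)
T-does⁺ (yes _) _ = tt
T-does⁺ (no ¬p) p = ¬p p

T-does⁻ : ∀ {P : Set} (p? : Dec P) → T (does p?) → P
T-does⁻ (yes p) _ = p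

module _ {n} {A : List (Vec Bool n)} (uA : Unique A) where

  isCubeAtᵇ-straddling : ∀ k d {x y} {X Y} → (x ∷ X) ∈ subsets A → (y ∷ Y) ∈ subsets A →
                         isCubeAtᵇ k d (layers (x ∷ X) (y ∷ Y)) ≡ does ((x ∷ X) ≟ᴸ (y ∷ Y)) ∧ isCubeAtᵇ-predDim k d (y ∷ Y)
  isCubeAtᵇ-straddling k d {x} {y} {X} {Y} X∈ Y∈ = T-ext forward (backward k)
    where
    forward : T (isCubeAtᵇ k d (layers (x ∷ X) (y ∷ Y))) → T (does ((x ∷ X) ≟ᴸ (y ∷ Y)) ∧ isCubeAtᵇ-predDim k d (y ∷ Y))
    forward t
      with cube , weight ← Equivalence.to (T-∧ {isCubeᵇ k (layers (x ∷ X) (y ∷ Y))}) t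
      with k′ , refl , X⊆Y , Y⊆X , cube′ ← straddling-cube {k} {V₀ = x ∷ X} {y ∷ Y} (∈-subsets⇒Unique uA X∈) (here refl) (here refl) cube
      with refl ← subsets-⊆-antisym uA X∈ Y∈ X⊆Y Y⊆X
      = Equivalence.from T-∧ (T-does⁺ ((x ∷ X) ≟ᴸ (x ∷ X)) refl , Equivalence.from T-∧ (cube′ , subst (λ m → T (m ≡ᵇ d)) (minWeight-layers-self x X) weight))
    backward : ∀ k → T (does ((x ∷ X) ≟ᴸ (y ∷ Y)) ∧ isCubeAtᵇ-predDim k d (y ∷ Y)) → T (isCubeAtᵇ k d (layers (x ∷ X) (y ∷ Y)))
    backward zero     t = ⊥-elim (proj₂ (Equivalence.to (T-∧ {does ((x ∷ X) ≟ᴸ (y ∷ Y))}) t))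
    backward (suc k′) t
      with equal , cube-weight ← Equivalence.to (T-∧ {does ((x ∷ X) ≟ᴸ (y ∷ Y))}) t
      with refl ← T-does⁻ ((x ∷ X) ≟ᴸ (y ∷ Y)) equal
      = let cube , weight = Equivalence.to T-∧ cube-weight
        in Equivalence.from T-∧ (doubled-cube {k′} (x ∷ X) cube , subst (λ m → T (m ≡ᵇ d)) (sym (minWeight-layers-self x X)) weight)

  𝟙-isCubeAtᵇ-layers :
    ∀ k d {X Y} → X ∈ subsets A → Y ∈ subsets A →
    𝟙 (isCubeAtᵇ k d (layers X Y)) ≡
    𝟙 (does (Y ≟ᴸ [])) * 𝟙 (isCubeAtᵇ k d X) + 𝟙 (does (X ≟ᴸ [])) * 𝟙 (isCubeAtᵇ-predWeight k d Y)
      + 𝟙 (does (X ≟ᴸ Y)) * 𝟙 (isCubeAtᵇ-predDim k d Y)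
  𝟙-isCubeAtᵇ-layers k d {[]} {[]} _ _
    = trans (cong 𝟙 (isCubeAtᵇ-[] {suc n} k d))
            (sym (cong₂ _+_ (cong₂ _+_ (cong (λ b → 1 * 𝟙 b) (isCubeAtᵇ-[] {n} k d))
                                       (cong (λ b → 1 * 𝟙 b) (isCubeAtᵇ-predWeight-[] {n} k d)))
                            (cong (λ b → 1 * 𝟙 b) (isCubeAtᵇ-predDim-[] {n} k d))))
  𝟙-isCubeAtᵇ-layers k d {[]} {y ∷ Y} _ _ =
    trans (cong 𝟙 (isCubeAtᵇ-map-true k d y Y)) (sym (trans (ℕ.+-identityʳ _) (ℕ.+-identityʳ _)))
  𝟙-isCubeAtᵇ-layers k d {x ∷ X} {[]} _ _ =
    trans (cong (𝟙 ∘ isCubeAtᵇ k d) (++-identityʳ (map (false ∷_) (x ∷ X))))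
          (trans (cong 𝟙 (isCubeAtᵇ-map-false k d (x ∷ X)))
                 (sym (trans (ℕ.+-identityʳ _) (trans (ℕ.+-identityʳ _) (ℕ.+-identityʳ _)))))
  𝟙-isCubeAtᵇ-layers k d {x ∷ X} {y ∷ Y} X∈ Y∈ =
    trans (cong 𝟙 (isCubeAtᵇ-straddling k d X∈ Y∈)) (𝟙-∧ (does ((x ∷ X) ≟ᴸ (y ∷ Y))) _)

  sum-𝟙-≟ᴸ : ∀ {Y} → Y ∈ subsets A → ∀ c → sumOver (λ X → 𝟙 (does (X ≟ᴸ Y)) * c) (subsets A) ≡ c
  sum-𝟙-≟ᴸ Y∈ c = trans (sumOver-*ʳ _ c (subsets A))
                        (trans (cong (_* c) (count-≡ _≟ᴸ_ (subsets-unique uA) Y∈)) (ℕ.*-identityˡ c))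

countSubsets-layers : ∀ {n} (P : List (Vec Bool (suc n)) → Bool) (A B : List (Vec Bool n)) →
  countSubsets P (layers A B) ≡ sumOver (λ X → sumOver (λ Y → 𝟙 (P (layers X Y))) (subsets B)) (subsets A)
countSubsets-layers P A B = begin
  sumOver (𝟙 ∘ P) (subsets (map (false ∷_) A ++ map (true ∷_) B))
    ≡⟨ cong (sumOver (𝟙 ∘ P)) (subsets-++ (map (false ∷_) A) (map (true ∷_) B)) ⟩
  sumOver (𝟙 ∘ P) (concatMap extend (subsets (map (false ∷_) A)))
    ≡⟨ sumOver-concatMap (𝟙 ∘ P) extend (subsets (map (false ∷_) A)) ⟩
  sumOver (sumOver (𝟙 ∘ P) ∘ extend) (subsets (map (false ∷_) A))
    ≡⟨ cong (sumOver (sumOver (𝟙 ∘ P) ∘ extend)) (subsets-map (false ∷_) A) ⟩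
  sumOver (sumOver (𝟙 ∘ P) ∘ extend) (map (map (false ∷_)) (subsets A))
    ≡⟨ sumOver-map (sumOver (𝟙 ∘ P) ∘ extend) (map (false ∷_)) (subsets A) ⟩
  sumOver (λ X → sumOver (𝟙 ∘ P) (extend (map (false ∷_) X))) (subsets A)
    ≡⟨ sumOver-cong (subsets A) (λ {X} _ → begin
         sumOver (𝟙 ∘ P) (map (map (false ∷_) X ++_) (subsets (map (true ∷_) B)))
           ≡⟨ cong (λ Ys → sumOver (𝟙 ∘ P) (map (map (false ∷_) X ++_) Ys)) (subsets-map (true ∷_) B) ⟩
         sumOver (𝟙 ∘ P) (map (map (false ∷_) X ++_) (map (map (true ∷_)) (subsets B)))
           ≡⟨ sumOver-map (𝟙 ∘ P) (map (false ∷_) X ++_) (map (map (true ∷_)) (subsets B)) ⟩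
         sumOver (λ Y → 𝟙 (P (map (false ∷_) X ++ Y))) (map (map (true ∷_)) (subsets B))
           ≡⟨ sumOver-map (λ Y → 𝟙 (P (map (false ∷_) X ++ Y))) (map (true ∷_)) (subsets B) ⟩
         sumOver (λ Y → 𝟙 (P (layers X Y))) (subsets B) ∎) ⟩
  sumOver (λ X → sumOver (λ Y → 𝟙 (P (layers X Y))) (subsets B)) (subsets A) ∎
  where
  open ≡-Reasoning
  extend : List (Vec Bool (suc _)) → List (List (Vec Bool (suc _)))
  extend X = map (X ++_) (subsets (map (true ∷_) B))

countSubsets-isCubeAtᵇ-layers :
  ∀ {n} k d (A : List (Vec Bool n)) (Z : Vec Bool n → Bool) → Unique A →
  countSubsets (isCubeAtᵇ k d) (layers A (filterᵇ Z A)) ≡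
  countSubsets (isCubeAtᵇ k d) A + countSubsets (isCubeAtᵇ-predWeight k d) (filterᵇ Z A)
    + countSubsets (isCubeAtᵇ-predDim k d) (filterᵇ Z A)
countSubsets-isCubeAtᵇ-layers k d A Z uA = begin
  countSubsets (isCubeAtᵇ k d) (layers A B)
    ≡⟨ countSubsets-layers (isCubeAtᵇ k d) A B ⟩
  sumOver (λ X → sumOver (λ Y → 𝟙 (isCubeAtᵇ k d (layers X Y))) (subsets B)) (subsets A)
    ≡⟨ sumOver-cong (subsets A) (λ X∈ → sumOver-cong (subsets B) (λ Y∈ →
         𝟙-isCubeAtᵇ-layers uA k d X∈ (∈-subsets-filterᵇ Z A Y∈))) ⟩
  sumOver (λ X → sumOver (λ Y → e₁ X Y + e₂ X Y + e₃ X Y) (subsets B)) (subsets A)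
    ≡⟨ sumOver-cong (subsets A) (λ {X} _ →
         trans (sumOver-+ (λ Y → e₁ X Y + e₂ X Y) (e₃ X) (subsets B))
               (cong (_+ sumOver (e₃ X) (subsets B)) (sumOver-+ (e₁ X) (e₂ X) (subsets B)))) ⟩
  sumOver (λ X → Σ₁ X + Σ₂ X + Σ₃ X) (subsets A)
    ≡⟨ trans (sumOver-+ (λ X → Σ₁ X + Σ₂ X) Σ₃ (subsets A))
             (cong (_+ sumOver Σ₃ (subsets A)) (sumOver-+ Σ₁ Σ₂ (subsets A))) ⟩
  sumOver Σ₁ (subsets A) + sumOver Σ₂ (subsets A) + sumOver Σ₃ (subsets A)
    ≡⟨ cong₂ _+_ (cong₂ _+_ part₁ part₂) part₃ ⟩
  countSubsets (isCubeAtᵇ k d) A + countSubsets (isCubeAtᵇ-predWeight k d) B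
    + countSubsets (isCubeAtᵇ-predDim k d) B ∎
  where
  open ≡-Reasoning
  B : List (Vec Bool _)
  B = filterᵇ Z A
  uB : Unique B
  uB = Unique.filter⁺ (T? ∘ Z) uA
  e₁ e₂ e₃ : List (Vec Bool _) → List (Vec Bool _) → ℕ
  e₁ X Y = 𝟙 (does (Y ≟ᴸ [])) * 𝟙 (isCubeAtᵇ k d X)
  e₂ X Y = 𝟙 (does (X ≟ᴸ [])) * 𝟙 (isCubeAtᵇ-predWeight k d Y)
  e₃ X Y = 𝟙 (does (X ≟ᴸ Y)) * 𝟙 (isCubeAtᵇ-predDim k d Y)
  Σ₁ Σ₂ Σ₃ : List (Vec Bool _) → ℕ
  Σ₁ X = sumOver (e₁ X) (subsets B)
  Σ₂ X = sumOver (e₂ X) (subsets B)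
  Σ₃ X = sumOver (e₃ X) (subsets B)
  part₁ : sumOver Σ₁ (subsets A) ≡ countSubsets (isCubeAtᵇ k d) A
  part₁ = sumOver-cong (subsets A) (λ {X} _ → sum-𝟙-≟ᴸ uB ([]∈subsets B) (𝟙 (isCubeAtᵇ k d X)))
  part₂ : sumOver Σ₂ (subsets A) ≡ countSubsets (isCubeAtᵇ-predWeight k d) B
  part₂ = trans (sumOver-comm e₂ (subsets A) (subsets B))
                (sumOver-cong (subsets B) (λ {Y} _ → sum-𝟙-≟ᴸ uA ([]∈subsets A) (𝟙 (isCubeAtᵇ-predWeight k d Y))))
  part₃ : sumOver Σ₃ (subsets A) ≡ countSubsets (isCubeAtᵇ-predDim k d) B
  part₃ = trans (sumOver-comm e₃ (subsets A) (subsets B))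
                (sumOver-cong (subsets B) (λ {Y} Y∈ → sum-𝟙-≟ᴸ uA (∈-subsets-filterᵇ Z A Y∈) (𝟙 (isCubeAtᵇ-predDim k d Y))))

-- Fibonacci strings

all-map : ∀ {A B : Set} (p : B → Bool) (f : A → B) xs → all p (map f xs) ≡ all (p ∘ f) xs
all-map p f xs = cong and (sym (map-∘ xs))

all-cong : ∀ {A : Set} {p q : A → Bool} → (∀ x → p x ≡ q x) → ∀ xs → all p xs ≡ all q xs
all-cong p≡q xs = cong and (map-cong p≡q xs)

all-true : ∀ {A : Set} (xs : List A) → all (λ _ → true) xs ≡ true
all-true []       = refl
all-true (x ∷ xs) = all-true xs

zeroPrefixᵇ : ℕ → ∀ {n} → Vec Bool n → Bool
zeroPrefixᵇ m {n} u = all (λ j → not (lookup u j) ∨ (m <ᵇ suc (toℕ j))) (allFins n)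

isFibᵇ-∷ : ∀ p {n} b (u : Vec Bool n) →
           isFibᵇ p (b ∷ u) ≡ all (λ j → not (b ∧ lookup u j) ∨ (p <ᵇ suc (toℕ j))) (allFins n) ∧ isFibᵇ p u
isFibᵇ-∷ p {n} b u = cong₂ _∧_ (all-map _ fs (allFins n))
  (trans (all-map _ fs (allFins n)) (all-cong (λ i → all-map _ fs (allFins n)) (allFins n)))

isFibᵇ-false∷ : ∀ p {n} (u : Vec Bool n) → isFibᵇ p (false ∷ u) ≡ isFibᵇ p u
isFibᵇ-false∷ p {n} u = trans (isFibᵇ-∷ p false u) (cong (_∧ isFibᵇ p u) (all-true (allFins n)))

isFibᵇ-true∷ : ∀ p {n} (u : Vec Bool n) → isFibᵇ p (true ∷ u) ≡ zeroPrefixᵇ p u ∧ isFibᵇ p u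
isFibᵇ-true∷ p u = isFibᵇ-∷ p true u

zeroPrefixᵇ-zero : ∀ {n} (u : Vec Bool n) → zeroPrefixᵇ 0 u ≡ true
zeroPrefixᵇ-zero {n} u = trans (all-cong (λ j → Bool.∨-zeroʳ (not (lookup u j))) (allFins n)) (all-true (allFins n))

zeroPrefixᵇ-suc : ∀ m {n} b (u : Vec Bool n) → zeroPrefixᵇ (suc m) (b ∷ u) ≡ (not b ∨ false) ∧ zeroPrefixᵇ m u
zeroPrefixᵇ-suc m {n} b u = cong ((not b ∨ false) ∧_) (all-map _ fs (allFins n))

module _ {A : Set} where

  filterᵇ-cong : ∀ {P Q : A → Bool} → (∀ x → P x ≡ Q x) → ∀ xs → filterᵇ P xs ≡ filterᵇ Q xs
  filterᵇ-cong             P≡Q []       = refl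
  filterᵇ-cong {P} {Q} P≡Q (x ∷ xs) with P x | Q x | P≡Q x
  ... | true  | .true  | refl = cong (x ∷_) (filterᵇ-cong P≡Q xs)
  ... | false | .false | refl = filterᵇ-cong P≡Q xs

  filterᵇ-map : ∀ {B : Set} (P : B → Bool) (g : A → B) xs → filterᵇ P (map g xs) ≡ map g (filterᵇ (P ∘ g) xs)
  filterᵇ-map P g []       = refl
  filterᵇ-map P g (x ∷ xs) with P (g x)
  ... | true  = cong (g x ∷_) (filterᵇ-map P g xs)
  ... | false = filterᵇ-map P g xs

fibVertices-suc-↭ : ∀ p n → fibVertices p (suc n) ↭ layers (fibVertices p n) (filterᵇ (zeroPrefixᵇ p) (fibVertices p n))
fibVertices-suc-↭ p n = split (allVecs n)
  where
  Fib : ∀ {m} → List (Vec Bool m) → List (Vec Bool m)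
  Fib = filterᵇ (isFibᵇ p)
  Fib? : (v : Vec Bool (suc n)) → Dec (T (isFibᵇ p v))
  Fib? = T? ∘ isFibᵇ p
  split : ∀ (V : List (Vec Bool n)) → Fib (concatMap bothPrefixes V) ↭ layers (Fib V) (filterᵇ (zeroPrefixᵇ p) (Fib V))
  split []      = ↭.refl
  split (v ∷ V) with isFibᵇ p v in fib | zeroPrefixᵇ p v in zp
  ... | false | _
    rewrite filter-reject Fib? {false ∷ v} {(true ∷ v) ∷ concatMap bothPrefixes V}
                          (subst T (trans (isFibᵇ-false∷ p v) fib))
          | filter-reject Fib? {true ∷ v} {concatMap bothPrefixes V}
                          (subst T (trans (isFibᵇ-true∷ p v) (trans (cong (zeroPrefixᵇ p v ∧_) fib) (Bool.∧-zeroʳ _))))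
    = split V
  ... | true | false
    rewrite filter-accept Fib? {false ∷ v} {(true ∷ v) ∷ concatMap bothPrefixes V}
                          (subst T (sym (trans (isFibᵇ-false∷ p v) fib)) tt)
          | filter-reject Fib? {true ∷ v} {concatMap bothPrefixes V}
                          (subst T (trans (isFibᵇ-true∷ p v) (cong₂ _∧_ zp fib)))
          | filter-reject (T? ∘ zeroPrefixᵇ p) {v} {Fib V} (subst T zp)
    = ↭.prep (false ∷ v) (split V)
  ... | true | true
    rewrite filter-accept Fib? {false ∷ v} {(true ∷ v) ∷ concatMap bothPrefixes V}
                          (subst T (sym (trans (isFibᵇ-false∷ p v) fib)) tt)
          | filter-accept Fib? {true ∷ v} {concatMap bothPrefixes V}
                          (subst T (sym (trans (isFibᵇ-true∷ p v) (cong₂ _∧_ zp fib))) tt)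
          | filter-accept (T? ∘ zeroPrefixᵇ p) {v} {Fib V} (subst T (sym zp) tt)
    = ↭.prep (false ∷ v) (↭.trans (↭.prep (true ∷ v) (split V))
                                  (↭.↭-sym (shift (true ∷ v) (map (false ∷_) (Fib V)) (map (true ∷_) (filterᵇ (zeroPrefixᵇ p) (Fib V))))))

countSubsets-map-false : ∀ {n} k d (X : List (Vec Bool n)) →
                         countSubsets (isCubeAtᵇ k d) (map (false ∷_) X) ≡ countSubsets (isCubeAtᵇ k d) X
countSubsets-map-false k d X =
  trans (cong (sumOver (𝟙 ∘ isCubeAtᵇ k d)) (subsets-map (false ∷_) X))
        (trans (sumOver-map _ (map (false ∷_)) (subsets X))
               (sumOver-cong (subsets X) (λ {S} _ → cong 𝟙 (isCubeAtᵇ-map-false k d S))))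

countSubsets-zeroPrefix : ∀ p m n k d →
  countSubsets (isCubeAtᵇ k d) (filterᵇ (zeroPrefixᵇ m) (fibVertices p n)) ≡ countSubsets (isCubeAtᵇ k d) (fibVertices p (n ∸ m))
countSubsets-zeroPrefix p zero    n       k d =
  cong (countSubsets (isCubeAtᵇ k d)) (filter-all (T? ∘ zeroPrefixᵇ 0) {fibVertices p n} (All.tabulate (λ {u} _ → subst T (sym (zeroPrefixᵇ-zero u)) tt)))
countSubsets-zeroPrefix p (suc m) zero    k d = refl
countSubsets-zeroPrefix p (suc m) (suc n) k d = begin
  countSubsets (isCubeAtᵇ k d) (filterᵇ (zeroPrefixᵇ (suc m)) (fibVertices p (suc n)))
    ≡⟨ countSubsets-↭ (isCubeAtᵇ-↭ k d) (filter-↭ (T? ∘ zeroPrefixᵇ (suc m)) (fibVertices-suc-↭ p n)) ⟩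
  countSubsets (isCubeAtᵇ k d) (filterᵇ (zeroPrefixᵇ (suc m)) (layers F B))
    ≡⟨ cong (countSubsets (isCubeAtᵇ k d)) first-layer ⟩
  countSubsets (isCubeAtᵇ k d) (map (false ∷_) (filterᵇ (zeroPrefixᵇ m) F))
    ≡⟨ countSubsets-map-false k d (filterᵇ (zeroPrefixᵇ m) F) ⟩
  countSubsets (isCubeAtᵇ k d) (filterᵇ (zeroPrefixᵇ m) F)
    ≡⟨ countSubsets-zeroPrefix p m n k d ⟩
  countSubsets (isCubeAtᵇ k d) (fibVertices p (n ∸ m)) ∎
  where
  open ≡-Reasoning
  F B : List (Vec Bool n)
  F = fibVertices p n
  B = filterᵇ (zeroPrefixᵇ p) F
  first-layer : filterᵇ (zeroPrefixᵇ (suc m)) (layers F B) ≡ map (false ∷_) (filterᵇ (zeroPrefixᵇ m) F)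
  first-layer = begin
    filterᵇ (zeroPrefixᵇ (suc m)) (map (false ∷_) F ++ map (true ∷_) B)
      ≡⟨ filter-++ (T? ∘ zeroPrefixᵇ (suc m)) (map (false ∷_) F) (map (true ∷_) B) ⟩
    filterᵇ (zeroPrefixᵇ (suc m)) (map (false ∷_) F) ++ filterᵇ (zeroPrefixᵇ (suc m)) (map (true ∷_) B)
      ≡⟨ cong₂ _++_ (trans (filterᵇ-map _ (false ∷_) F) (cong (map (false ∷_)) (filterᵇ-cong (zeroPrefixᵇ-suc m false) F)))
                    (trans (filterᵇ-map _ (true ∷_) B)
                           (cong (map (true ∷_)) (filter-none (T? ∘ zeroPrefixᵇ (suc m) ∘ (true ∷_)) {B}
                                                              (All.tabulate (λ {u} _ → subst T (zeroPrefixᵇ-suc m true u)))))) ⟩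
    map (false ∷_) (filterᵇ (zeroPrefixᵇ m) F) ++ []
      ≡⟨ ++-identityʳ _ ⟩
    map (false ∷_) (filterᵇ (zeroPrefixᵇ m) F) ∎

cFib≡countSubsets : ∀ p n k d → cFib p n k d ≡ countSubsets (isCubeAtᵇ k d) (fibVertices p n)
cFib≡countSubsets p n k d = length-filterᵇ (isCubeAtᵇ k d) (subsets (fibVertices p n))

cFib-suc : ∀ p n k d →
  cFib p (suc n) k d ≡
  cFib p n k d + countSubsets (isCubeAtᵇ-predWeight k d) (filterᵇ (zeroPrefixᵇ p) (fibVertices p n))
    + countSubsets (isCubeAtᵇ-predDim k d) (filterᵇ (zeroPrefixᵇ p) (fibVertices p n))
cFib-suc p n k d = begin
  cFib p (suc n) k d
    ≡⟨ cFib≡countSubsets p (suc n) k d ⟩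
  countSubsets (isCubeAtᵇ k d) (fibVertices p (suc n))
    ≡⟨ countSubsets-↭ (isCubeAtᵇ-↭ k d) (fibVertices-suc-↭ p n) ⟩
  countSubsets (isCubeAtᵇ k d) (layers F B)
    ≡⟨ countSubsets-isCubeAtᵇ-layers k d F (zeroPrefixᵇ p) (Unique.filter⁺ (T? ∘ isFibᵇ p) (allVecs-unique n)) ⟩
  countSubsets (isCubeAtᵇ k d) F + countSubsets (isCubeAtᵇ-predWeight k d) B + countSubsets (isCubeAtᵇ-predDim k d) B
    ≡⟨ cong (λ c → c + countSubsets (isCubeAtᵇ-predWeight k d) B + countSubsets (isCubeAtᵇ-predDim k d) B)
            (cFib≡countSubsets p n k d) ⟨
  cFib p n k d + countSubsets (isCubeAtᵇ-predWeight k d) B + countSubsets (isCubeAtᵇ-predDim k d) B ∎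
  where
  open ≡-Reasoning
  F B : List (Vec Bool n)
  F = fibVertices p n
  B = filterᵇ (zeroPrefixᵇ p) F

-- The recurrence

Dfib-zero : ∀ p k d → Dfib p 0 k d ≡ 1ᴾ k d
Dfib-zero p zero    zero    = refl
Dfib-zero p zero    (suc d) = refl
Dfib-zero p (suc k) d       = cong ℤ.+_ (trans (cFib≡countSubsets p 0 (suc k) d) (cong₂ (λ a b → 𝟙 a + (𝟙 b + 0))
  (isCubeAtᵇ-length {suc k} d {[] ∷ []} 1≢2^suc) (isCubeAtᵇ-[] (suc k) d)))
  where
  1≢2^suc : 1 ≢ 2 ^ suc k
  1≢2^suc 1≡ with ℕ.m^n≡1⇒n≡0∨m≡1 2 (suc k) (sym 1≡)
  ... | inj₁ ()
  ... | inj₂ ()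

Dfib-suc : ∀ p m k d → Dfib p (suc m) k d ≡ Dfib p m k d ℤ.+ (Dfib p (m ∸ p) *ᴾ q+xᴾ) k d
Dfib-suc p m k d = begin
  ℤ.+ cFib p (suc m) k d
    ≡⟨ cong ℤ.+_ (trans (cFib-suc p m k d) (ℕ.+-assoc (cFib p m k d) weight-shifted dim-shifted)) ⟩
  Dfib p m k d ℤ.+ (ℤ.+ weight-shifted ℤ.+ ℤ.+ dim-shifted)
    ≡⟨ cong (λ z → Dfib p m k d ℤ.+ z) (ℤ.+-comm (ℤ.+ weight-shifted) (ℤ.+ dim-shifted)) ⟩
  Dfib p m k d ℤ.+ (ℤ.+ dim-shifted ℤ.+ ℤ.+ weight-shifted)
    ≡⟨ cong (λ z → Dfib p m k d ℤ.+ z) (cong₂ ℤ._+_ (x·-count k) (q·-count d)) ⟩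
  Dfib p m k d ℤ.+ ((x· Dfib p (m ∸ p)) k d ℤ.+ (q· Dfib p (m ∸ p)) k d)
    ≡⟨ cong (λ z → Dfib p m k d ℤ.+ z) (*ᴾ-q+xᴾ (Dfib p (m ∸ p)) k d) ⟨
  Dfib p m k d ℤ.+ (Dfib p (m ∸ p) *ᴾ q+xᴾ) k d ∎
  where
  open ≡-Reasoning
  B : List (Vec Bool m)
  B = filterᵇ (zeroPrefixᵇ p) (fibVertices p m)
  weight-shifted dim-shifted : ℕ
  weight-shifted = countSubsets (isCubeAtᵇ-predWeight k d) B
  dim-shifted    = countSubsets (isCubeAtᵇ-predDim k d) B
  shifted : ∀ k d → ℤ.+ countSubsets (isCubeAtᵇ k d) B ≡ Dfib p (m ∸ p) k d
  shifted k d = cong ℤ.+_ (trans (countSubsets-zeroPrefix p p m k d) (sym (cFib≡countSubsets p (m ∸ p) k d)))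
  q·-count : ∀ d → ℤ.+ countSubsets (isCubeAtᵇ-predWeight k d) B ≡ (q· Dfib p (m ∸ p)) k d
  q·-count zero    = cong ℤ.+_ (sumOver-zero (subsets B) (λ _ → refl))
  q·-count (suc d) = shifted k d
  x·-count : ∀ k → ℤ.+ countSubsets (isCubeAtᵇ-predDim k d) B ≡ (x· Dfib p (m ∸ p)) k d
  x·-count zero    = cong ℤ.+_ (sumOver-zero (subsets B) (λ _ → refl))
  x·-count (suc k) = shifted k d

theorem5p4 : (p : ℕ) → p ≥ 1 →
    (n k d : ℕ) → (genFun p *ˢ denom p) n k d ≡ numer p n k d
theorem5p4 p _ = recurrence⇒*ˢdenom≡numer p (genFun p) (Dfib-zero p) (Dfib-suc p)
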